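{- Let $\Gamma$ be the class of finite, simple, undirected, connected, non-complete graphs. For $G\in\Gamma$ on $n$ vertices with vertex set $V$ and minimum degree $\delta$, and $t\in\{1,\dots,n-\delta\}$, put $a(G,t)=t+\sum_{u\in V}\binom{n-d(u)-1}{t}/\binom{n}{t}$, $b(G,t)=\sum_{u\in V}\binom{n-d(u)-1}{t}/\binom{n}{t}+2\sum_{\{u,v\}\in\binom{V}{2}}\binom{n-|N[u]\cup N[v]|}{t}/\binom{n}{t}$, $c(G,t)=\sum_{u\in V}\binom{n-d(u)-1}{t}/\binom{n}{t}+2\sum_{\{u,v\}\in\binom{V}{2}}\binom{n-d(u)-d(v)-2}{t}/\binom{n}{t}$, and define $$\gamma_{CSSF}(G)=\min_{t\in\{1,\dots,n-\delta\}}a(G,t),$$ $$\gamma_{HM1}(G)=\min_{t\in\{1,\dots,n-\delta\}}\left(a(G,t)-\frac{b(G,t)-(a(G,t)-t)^2}{n-a(G,t)}\right),\quad \gamma_{HM2}(G)=\min_{t\in\{1,\dots,n-\delta\}}\left(a(G,t)-\frac{c(G,t)-(a(G,t)-t)^2}{n-a(G,t)}\right).$$ Then: 1. $\gamma_{HM1}(G)\le\gamma_{CSSF}(G)$ and $\gamma_{HM1}(G)\le\gamma_{HM2}(G)$ for all $G\in\Gamma$. 2. $\gamma_{HM2}$ and $\gamma_{CSSF}$ are incomparable, i.e. there exist $G_1,G_2\in\Gamma$ with $\gamma_{HM2}(G_1)<\gamma_{CSSF}(G_1)$ and $\gamma_{CSSF}(G_2)<\gamma_{HM2}(G_2)$.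 3. There is a sequence $(G_m)$ of graphs in $\Gamma$ such that $\lim_{m\to\infty}\gamma_{HM1}(G_m)/\gamma_{CSSF}(G_m)=0$.
   Context: For $u\in V$, $N(u)$ is the neighborhood, $d(u)=|N(u)|$, $N[u]=N(u)\cup\{u\}$. $\binom{V}{2}$ is the set of 2-element subsets of $V$. Binomial coefficients $\binom{m}{k}$ count $k$-element subsets of an $m$-element set, with $\binom{m}{k}=0$ if $k<0$ or $k>m$ (in particular whenever $m<k$, including $m<0$). One has $a(G,t)<n$ for all such $t$, so the quantities are well defined. -}

module Defs where

open import Data.Bool using (Bool; true; false; if_then_else_; _∨_)
open import Data.Nat as ℕ using (ℕ; zero; suc; _∸_; _<ᵇ_; _≤ᵇ_)
open import Data.Nat.Combinatorics using (_C_)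
open import Data.Fin using (Fin; toℕ)
open import Data.Fin.Properties using () renaming (_≟_ to _≟ᶠ_)
open import Data.Integer using (ℤ; +_; -[1+_])
import Data.Integer
open import Data.Rational using (ℚ; mkℚ; 0ℚ; _/_; _÷_; _+_; _-_; _*_; _⊓_)
open import Data.Product using (Σ; _×_; ∃)
open import Relation.Binary.PropositionalEquality using (_≡_)
open import Relation.Nullary using (¬_; does)

record Graph (n : ℕ) : Set where
  field
    adj    : Fin n → Fin n → Bool
    sym    : ∀ u v → adj u v ≡ adj v u
    irrefl : ∀ u → adj u u ≡ false
open Graph public

data Reach {n : ℕ} (G : Graph n) : Fin n → Fin n → Set where
  here : ∀ {u} → Reach G u u
  step : ∀ {u w v} → adj G u w ≡ true → Reach G w v → Reach G u v

Connected : ∀ {n} → Graph n → Set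
Connected G = ∀ u v → Reach G u v

NonComplete : ∀ {n} → Graph n → Set
NonComplete {n} G = Σ (Fin n) λ u → Σ (Fin n) λ v → ¬ (u ≡ v) × adj G u v ≡ false

-- the class Γ: connected, non-complete (finite simple undirected by construction)
InΓ : ∀ {n} → Graph n → Set
InΓ G = Connected G × NonComplete G

sumFin : ∀ {n} → (Fin n → ℕ) → ℕ
sumFin {zero}  f = 0
sumFin {suc n} f = f Data.Fin.zero ℕ.+ sumFin (λ i → f (Data.Fin.suc i))

-- sum over 2-element subsets {u,v} (each counted once, via toℕ u < toℕ v)
sumPairs : ∀ {n} → (Fin n → Fin n → ℕ) → ℕ
sumPairs f = sumFin (λ u → sumFin (λ v → if toℕ u <ᵇ toℕ v then f u v else 0))

count : ∀ {n} → (Fin n → Bool) → ℕ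
count p = sumFin (λ i → if p i then 1 else 0)

deg : ∀ {n} → Graph n → Fin n → ℕ
deg G u = count (adj G u)

closedUnion : ∀ {n} → Graph n → Fin n → Fin n → ℕ
closedUnion G u v =
  count (λ w → does (w ≟ᶠ u) ∨ does (w ≟ᶠ v) ∨ adj G u w ∨ adj G v w)

-- minimum degree (foldr of ⊓ starting at n; equals δ whenever n ≥ 1)
minFin : ∀ {n} → ℕ → (Fin n → ℕ) → ℕ
minFin {zero}  b f = b
minFin {suc n} b f = f Data.Fin.zero ℕ.⊓ minFin b (λ i → f (Data.Fin.suc i))

δ : ∀ {n} → Graph n → ℕ
δ {n} G = minFin n (deg G)

-- binomial coefficient with integer top argument; 0 when the top is negative
choose : ℤ → ℕ → ℕ
choose (+ m)    k = m C k
choose -[1+ m ] k = 0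

_⊖ℕ_ : ℕ → ℕ → ℤ
m ⊖ℕ a = m Data.Integer.⊖ a

ℕtoℚ : ℕ → ℚ
ℕtoℚ k = + k / 1

-- total division on ℚ (x ÷ᵗ 0 = 0); only applied to nonzero denominators
_÷ᵗ_ : ℚ → ℚ → ℚ
p ÷ᵗ mkℚ (+ zero) _ _ = 0ℚ
p ÷ᵗ q@(mkℚ (+ suc _) _ _) = p ÷ q
p ÷ᵗ q@(mkℚ -[1+ _ ] _ _) = p ÷ q
infixl 7 _÷ᵗ_

module _ {n : ℕ} (G : Graph n) (t : ℕ) where
  private
    Cnt : ℚ
    Cnt = ℕtoℚ (n C t)

  S₁ : ℚ
  S₁ = ℕtoℚ (sumFin (λ u → choose (n ⊖ℕ (deg G u ℕ.+ 1)) t)) ÷ᵗ Cnt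

  aG : ℚ
  aG = ℕtoℚ t + S₁

  bG : ℚ
  bG = S₁ + ℕtoℚ 2 * (ℕtoℚ (sumPairs (λ u v → choose (n ⊖ℕ closedUnion G u v) t)) ÷ᵗ Cnt)

  cG : ℚ
  cG = S₁ + ℕtoℚ 2 * (ℕtoℚ (sumPairs (λ u v → choose (n ⊖ℕ (deg G u ℕ.+ deg G v ℕ.+ 2)) t)) ÷ᵗ Cnt)

  hm1Term : ℚ
  hm1Term = aG - (bG - (aG - ℕtoℚ t) * (aG - ℕtoℚ t)) ÷ᵗ (ℕtoℚ n - aG)

  hm2Term : ℚ
  hm2Term = aG - (cG - (aG - ℕtoℚ t) * (aG - ℕtoℚ t)) ÷ᵗ (ℕtoℚ n - aG)

-- minRange f k = min { f t | t ∈ {1,…,k} }   (for k ≥ 1; minRange f 0 = f 1, unused)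
minRange : (ℕ → ℚ) → ℕ → ℚ
minRange f zero = f 1
minRange f (suc zero) = f 1
minRange f (suc (suc k)) = minRange f (suc k) ⊓ f (suc (suc k))

γCSSF : ∀ {n} → Graph n → ℚ
γCSSF {n} G = minRange (aG G) (n ∸ δ G)

γHM1 : ∀ {n} → Graph n → ℚ
γHM1 {n} G = minRange (hm1Term G) (n ∸ δ G)

γHM2 : ∀ {n} → Graph n → ℚ
γHM2 {n} G = minRange (hm2Term G) (n ∸ δ G)

module Submission where

-- (1) Fix t ≤ n and pick a t-subset X of the vertices uniformly at random.  Let
--     Y(X) be the number of vertices u whose closed neighbourhood N[u] misses X.
--     Counting the t-subsets that avoid a given set gives  E[Y] = a(G,t) - t
--     and  E[Y²] = b(G,t).  Cauchy–Schwarz (E[Y]² ≤ E[Y²]) makes the numerator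
--     b - (a-t)² of the HM1 correction non-negative, and Y ≤ n - t (a counted
--     vertex u ∈ N[u] lies outside X) makes its denominator n - a non-negative;
--     so every HM1 term is ≤ a(G,t).  Since |N[u] ∪ N[v]| ≤ d(u) + d(v) + 2,
--     also c(G,t) ≤ b(G,t), so every HM1 term is ≤ the HM2 term.  Minima over t
--     preserve both inequalities.
-- (2) Both strict inequalities are decided by evaluation on the stars K₁,₃, K₁,₄.
-- (3) For the star K₁,L (n = L + 1) and 1 ≤ t ≤ L, with j = L - t, the terms have
--     the closed forms  a = t + j(j+1)/(L+1)  and  HM1 = t + j/(t+1).  Thus
--     4a ≥ L for every t, while HM1 ≤ 2k at t = k when L = k²; the ratio
--     γHM1/γCSSF is at most 8/k and tends to 0.

import Data.Nat as ℕ
open ℕ using (ℕ)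
open import Defs using (Graph)
open import Relation.Binary.PropositionalEquality using (_≡_)

module Binomial where

  open import Data.Nat
  open import Data.Nat.Properties
  open import Data.Nat.Tactic.RingSolver using (solve-∀)
  open import Data.Nat.Combinatorics using (_C_; nCk+nC[k+1]≡[n+1]C[k+1])
  open import Data.Integer using () renaming (+_ to pos; -_ to neg)
  import Data.Integer.Properties as ℤP
  open import Relation.Binary.PropositionalEquality
  open import Relation.Nullary using (yes; no)
  open import Defs using (choose; _⊖ℕ_)

  -- Binomial coefficients via Pascal's rule: structurally recursive, so
  -- convenient for induction; they agree with the library's _C_.
  B : ℕ → ℕ → ℕ
  B _ zero = 1
  B zero (suc k) = 0
  B (suc n) (suc k) = B n k + B n (suc k)

  B≡C : ∀ n k → B n k ≡ n C k
  B≡C n zero = refl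
  B≡C zero (suc k) = refl
  B≡C (suc n) (suc k) =
    trans (cong₂ _+_ (B≡C n k) (B≡C n (suc k))) (nCk+nC[k+1]≡[n+1]C[k+1] n k)

  B-mono : ∀ {m m'} t → m ≤ m' → B m t ≤ B m' t
  B-mono zero p = ≤-refl
  B-mono {zero} (suc t) p = z≤n
  B-mono {suc m} {suc m'} (suc t) (s≤s p) = +-mono-≤ (B-mono t p) (B-mono (suc t) p)

  B-pos : ∀ n t → t ≤ n → 0 < B n t
  B-pos n zero _ = s≤s z≤n
  B-pos (suc n) (suc t) (s≤s p) = ≤-trans (B-pos n t p) (m≤m+n _ _)

  B-vanishes : ∀ m t → m < t → B m t ≡ 0
  B-vanishes zero (suc t) _ = refl
  B-vanishes (suc m) (suc t) (s≤s p) =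
    cong₂ _+_ (B-vanishes m t p) (B-vanishes m (suc t) (m≤n⇒m≤1+n p))

  B-absorption : ∀ m t → suc t * B (suc m) (suc t) ≡ suc m * B m t
  B-absorption zero zero = refl
  B-absorption zero (suc t) = *-zeroʳ (suc (suc t))
  B-absorption (suc m) zero =
    trans (+-identityʳ _) (cong suc (trans (sym (*-identityˡ (B (suc m) 1))) (B-absorption m zero)))
  B-absorption (suc m) (suc t) = begin
      (2 + t) * (X + Y)                                                 ≡⟨ expand t X Y ⟩
      (1 + t) * X + X + (2 + t) * Y                                     ≡⟨ cong₂ (λ p q → p + X + q) (B-absorption m t) (B-absorption m (suc t)) ⟩
      (1 + m) * B m t + (B m t + B m (suc t)) + (1 + m) * B m (suc t)   ≡⟨ collect m (B m t) (B m (suc t)) ⟩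
      (2 + m) * X                                                       ∎
    where
    open ≡-Reasoning
    X Y : ℕ
    X = B (suc m) (suc t)
    Y = B (suc m) (suc (suc t))
    expand : ∀ t X Y → (2 + t) * (X + Y) ≡ (1 + t) * X + X + (2 + t) * Y
    expand = solve-∀
    collect : ∀ m a₁ a₂ → (1 + m) * a₁ + (a₁ + a₂) + (1 + m) * a₂ ≡ (2 + m) * (a₁ + a₂)
    collect = solve-∀

  B-raise : ∀ m t → suc m * B m t ≡ (suc m ∸ t) * B (suc m) t
  B-raise m zero = refl
  B-raise m (suc t) = sym (begin
      (suc m ∸ suc t) * B (suc m) (suc t)
        ≡⟨ *-distribʳ-∸ (B (suc m) (suc t)) (suc m) (suc t) ⟩
      suc m * B (suc m) (suc t) ∸ suc t * B (suc m) (suc t)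
        ≡⟨ cong₂ _∸_ (*-distribˡ-+ (suc m) (B m t) (B m (suc t))) (B-absorption m t) ⟩
      (suc m * B m t + suc m * B m (suc t)) ∸ suc m * B m t
        ≡⟨ m+n∸m≡n (suc m * B m t) _ ⟩
      suc m * B m (suc t) ∎)
    where open ≡-Reasoning

  choose-≥ : ∀ n k t → k ≤ n → choose (n ⊖ℕ k) t ≡ B (n ∸ k) t
  choose-≥ n k t p = trans (cong (λ z → choose z t) (ℤP.⊖-≥ p)) (sym (B≡C (n ∸ k) t))

  choose-< : ∀ n k t → n < k → choose (n ⊖ℕ k) t ≡ 0
  choose-< n k t p = trans (cong (λ z → choose z t) (ℤP.⊖-< p)) (negative (k ∸ n) (m<n⇒0<n∸m p))
    where
    negative : ∀ m → 0 < m → choose (neg (pos m)) t ≡ 0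
    negative (suc m) _ = refl

  choose-antitone : ∀ n {k k'} t → k ≤ k' → choose (n ⊖ℕ k') t ≤ choose (n ⊖ℕ k) t
  choose-antitone n {k} {k'} t p with k' ≤? n
  ... | yes k'≤n = subst₂ _≤_ (sym (choose-≥ n k' t k'≤n)) (sym (choose-≥ n k t (≤-trans p k'≤n)))
                     (B-mono t (∸-monoʳ-≤ n p))
  ... | no k'≰n = subst (_≤ choose (n ⊖ℕ k) t) (sym (choose-< n k' t (≰⇒> k'≰n))) z≤n

module FiniteSums where

  open import Data.Nat
  open import Data.Nat.Properties
  open import Data.Nat.Tactic.RingSolver using (solve-∀)
  open import Data.Bool using (Bool; true; false; not; _∨_; if_then_else_; T)
  open import Data.Fin using (Fin; zero; suc; toℕ)
  open import Data.Fin.Properties using () renaming (_≟_ to _≟ᶠ_)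
  open import Data.List using (List; []; _∷_; _++_; map)
  open import Data.List.Relation.Unary.All using (All; []; _∷_)
  open import Relation.Binary.PropositionalEquality
  open import Relation.Nullary using (does)
  open import Defs using (sumFin; sumPairs; count)

  ind : Bool → ℕ
  ind b = if b then 1 else 0

  lsum : {A : Set} → List A → (A → ℕ) → ℕ
  lsum [] f = 0
  lsum (x ∷ xs) f = f x + lsum xs f

  lsum-++ : {A : Set} (xs ys : List A) (f : A → ℕ) → lsum (xs ++ ys) f ≡ lsum xs f + lsum ys f
  lsum-++ [] ys f = refl
  lsum-++ (x ∷ xs) ys f = trans (cong (f x +_) (lsum-++ xs ys f)) (sym (+-assoc (f x) _ _))

  lsum-map : {A C : Set} (g : A → C) (xs : List A) (f : C → ℕ) → lsum (map g xs) f ≡ lsum xs (λ x → f (g x))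
  lsum-map g [] f = refl
  lsum-map g (x ∷ xs) f = cong (f (g x) +_) (lsum-map g xs f)

  lsum-ext : {A : Set} (xs : List A) {f g : A → ℕ} → (∀ x → f x ≡ g x) → lsum xs f ≡ lsum xs g
  lsum-ext [] e = refl
  lsum-ext (x ∷ xs) e = cong₂ _+_ (e x) (lsum-ext xs e)

  lsum-mono : {A : Set} (xs : List A) {f g : A → ℕ} → All (λ x → f x ≤ g x) xs → lsum xs f ≤ lsum xs g
  lsum-mono [] [] = z≤n
  lsum-mono (x ∷ xs) (p ∷ ps) = +-mono-≤ p (lsum-mono xs ps)

  lsum-zero : {A : Set} (xs : List A) → lsum xs (λ _ → 0) ≡ 0
  lsum-zero [] = refl
  lsum-zero (x ∷ xs) = lsum-zero xs

  lsum-const : {A : Set} (xs : List A) (c : ℕ) → lsum xs (λ _ → c) ≡ lsum xs (λ _ → 1) * c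
  lsum-const [] c = refl
  lsum-const (x ∷ xs) c = cong (c +_) (lsum-const xs c)

  private
    interchange : ∀ a b c d → a + b + (c + d) ≡ a + c + (b + d)
    interchange = solve-∀

  sumFin-ext : ∀ {n} {f g : Fin n → ℕ} → (∀ i → f i ≡ g i) → sumFin f ≡ sumFin g
  sumFin-ext {zero} e = refl
  sumFin-ext {suc n} e = cong₂ _+_ (e zero) (sumFin-ext (λ i → e (suc i)))

  sumFin-mono : ∀ {n} {f g : Fin n → ℕ} → (∀ i → f i ≤ g i) → sumFin f ≤ sumFin g
  sumFin-mono {zero} e = z≤n
  sumFin-mono {suc n} e = +-mono-≤ (e zero) (sumFin-mono (λ i → e (suc i)))

  sumFin-const : ∀ {n} (c : ℕ) → sumFin {n} (λ _ → c) ≡ n * c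
  sumFin-const {zero} c = refl
  sumFin-const {suc n} c = cong (c +_) (sumFin-const {n} c)

  sumFin-+ : ∀ {n} (f g : Fin n → ℕ) → sumFin (λ i → f i + g i) ≡ sumFin f + sumFin g
  sumFin-+ {zero} f g = refl
  sumFin-+ {suc n} f g =
    trans (cong ((f zero + g zero) +_) (sumFin-+ (λ i → f (suc i)) (λ i → g (suc i))))
          (interchange (f zero) (g zero) _ _)

  sumFin-*ˡ : ∀ {n} (c : ℕ) (f : Fin n → ℕ) → c * sumFin f ≡ sumFin (λ i → c * f i)
  sumFin-*ˡ {zero} c f = *-zeroʳ c
  sumFin-*ˡ {suc n} c f =
    trans (*-distribˡ-+ c (f zero) _) (cong (c * f zero +_) (sumFin-*ˡ c (λ i → f (suc i))))

  sumFin-*ʳ : ∀ {n} (c : ℕ) (f : Fin n → ℕ) → sumFin f * c ≡ sumFin (λ i → f i * c)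
  sumFin-*ʳ c f = trans (*-comm _ c) (trans (sumFin-*ˡ c f) (sumFin-ext (λ i → *-comm c (f i))))

  lsum-sumFin : ∀ {A : Set} {n} (xs : List A) (f : A → Fin n → ℕ) →
    lsum xs (λ x → sumFin (f x)) ≡ sumFin (λ i → lsum xs (λ x → f x i))
  lsum-sumFin {n = n} [] f = sym (trans (sumFin-const {n} 0) (*-zeroʳ n))
  lsum-sumFin (x ∷ xs) f =
    trans (cong (sumFin (f x) +_) (lsum-sumFin xs f)) (sym (sumFin-+ (f x) _))

  sumPairs-ext : ∀ {n} {f g : Fin n → Fin n → ℕ} → (∀ u v → toℕ u < toℕ v → f u v ≡ g u v) →
    sumPairs f ≡ sumPairs g
  sumPairs-ext {f = f} {g} e = sumFin-ext (λ u → sumFin-ext (λ v → onPair u v))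
    where
    onPair : ∀ u v → (if toℕ u <ᵇ toℕ v then f u v else 0) ≡ (if toℕ u <ᵇ toℕ v then g u v else 0)
    onPair u v with toℕ u <ᵇ toℕ v in eq
    ... | true = e u v (<ᵇ⇒< (toℕ u) (toℕ v) (subst T (sym eq) _))
    ... | false = refl

  sumPairs-mono : ∀ {n} {f g : Fin n → Fin n → ℕ} → (∀ u v → f u v ≤ g u v) → sumPairs f ≤ sumPairs g
  sumPairs-mono {f = f} {g} le = sumFin-mono (λ u → sumFin-mono (λ v → onPair u v))
    where
    onPair : ∀ u v → (if toℕ u <ᵇ toℕ v then f u v else 0) ≤ (if toℕ u <ᵇ toℕ v then g u v else 0)
    onPair u v with toℕ u <ᵇ toℕ v
    ... | true = le u v
    ... | false = z≤n

  double-sum-symmetric : ∀ {n} (f : Fin n → Fin n → ℕ) → (∀ u v → f u v ≡ f v u) →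
    sumFin (λ u → sumFin (λ v → f u v)) ≡ sumFin (λ u → f u u) + 2 * sumPairs f
  double-sum-symmetric {zero} f s = refl
  double-sum-symmetric {suc n} f s = begin
      (f zero zero + A) + sumFin (λ u → f (suc u) zero + sumFin (λ v → f (suc u) (suc v)))
        ≡⟨ cong ((f zero zero + A) +_)
             (trans (sumFin-+ (λ u → f (suc u) zero) _)
                    (cong₂ _+_ (sumFin-ext (λ u → s (suc u) zero))
                               (double-sum-symmetric (λ u v → f (suc u) (suc v)) (λ u v → s (suc u) (suc v))))) ⟩
      (f zero zero + A) + (A + (D + 2 * P))
        ≡⟨ regroup (f zero zero) A D P ⟩
      (f zero zero + D) + 2 * (A + P) ∎
    where
    open ≡-Reasoning
    A D P : ℕ
    A = sumFin (λ v → f zero (suc v))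
    D = sumFin (λ u → f (suc u) (suc u))
    P = sumPairs (λ u v → f (suc u) (suc v))
    regroup : ∀ a b c d → (a + b) + (b + (c + 2 * d)) ≡ (a + c) + 2 * (b + d)
    regroup = solve-∀

  count-ext : ∀ {n} {p q : Fin n → Bool} → (∀ w → p w ≡ q w) → count p ≡ count q
  count-ext e = sumFin-ext (λ w → cong ind (e w))

  count-≤ : ∀ {n} (p : Fin n → Bool) → count p ≤ n
  count-≤ {zero} p = z≤n
  count-≤ {suc n} p with p zero
  ... | true = s≤s (count-≤ (λ i → p (suc i)))
  ... | false = m≤n⇒m≤1+n (count-≤ (λ i → p (suc i)))

  count-false : ∀ n → count {n} (λ _ → false) ≡ 0
  count-false zero = refl
  count-false (suc n) = count-false n

  count-true : ∀ {n} (p : Fin n → Bool) → (∀ w → p w ≡ true) → count p ≡ n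
  count-true {zero} p h = refl
  count-true {suc n} p h rewrite h zero = cong suc (count-true (λ i → p (suc i)) (λ i → h (suc i)))

  count-complement : ∀ {n} (p : Fin n → Bool) → count p + count (λ w → not (p w)) ≡ n
  count-complement {zero} p = refl
  count-complement {suc n} p with p zero
  ... | true = cong suc (count-complement (λ i → p (suc i)))
  ... | false = trans (+-suc _ _) (cong suc (count-complement (λ i → p (suc i))))

  count-∨ : ∀ {n} (p q : Fin n → Bool) → count (λ w → p w ∨ q w) ≤ count p + count q
  count-∨ {zero} p q = z≤n
  count-∨ {suc n} p q =
    ≤-trans (+-mono-≤ (ind-∨ (p zero) (q zero)) (count-∨ (λ i → p (suc i)) (λ i → q (suc i))))
            (≤-reflexive (interchange (ind (p zero)) (ind (q zero)) _ _))
    where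
    ind-∨ : ∀ a b → ind (a ∨ b) ≤ ind a + ind b
    ind-∨ false b = ≤-refl
    ind-∨ true b = s≤s z≤n

  count-singleton : ∀ {n} (u : Fin n) → count (λ w → does (w ≟ᶠ u)) ≡ 1
  count-singleton {suc n} zero = cong suc (count-false n)
  count-singleton {suc n} (suc u) = count-singleton u

  count-insert : ∀ {n} (u : Fin n) (p : Fin n → Bool) → p u ≡ false →
    count (λ w → does (w ≟ᶠ u) ∨ p w) ≡ suc (count p)
  count-insert {suc n} zero p e rewrite e = refl
  count-insert {suc n} (suc u) p e =
    trans (cong (ind (p zero) +_) (count-insert u (λ i → p (suc i)) e)) (+-suc _ _)

module CauchySchwarz where

  open import Data.Nat
  open import Data.Nat.Properties
  open import Data.Nat.Tactic.RingSolver using (solve-∀)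
  open import Data.Product using (_,_)
  open import Data.Sum using (inj₁; inj₂)
  open import Data.List using (List; []; _∷_)
  open import Relation.Binary.PropositionalEquality
  open FiniteSums using (lsum)

  private
    am-gm-≤ : ∀ {a b} → a ≤ b → 2 * (a * b) ≤ a * a + b * b
    am-gm-≤ {a} p with m≤n⇒∃[o]m+o≡n p
    ... | d , refl = subst (2 * (a * (a + d)) ≤_) (square a d) (m≤m+n _ (d * d))
      where
      square : ∀ a d → 2 * (a * (a + d)) + d * d ≡ a * a + (a + d) * (a + d)
      square = solve-∀

  am-gm : ∀ a b → 2 * (a * b) ≤ a * a + b * b
  am-gm a b with ≤-total a b
  ... | inj₁ a≤b = am-gm-≤ a≤b
  ... | inj₂ b≤a = subst₂ _≤_ (cong (2 *_) (*-comm b a)) (+-comm (b * b) (a * a)) (am-gm-≤ b≤a)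

  cross-term : {A : Set} (xs : List A) (g : A → ℕ) (y : ℕ) →
    2 * (y * lsum xs g) ≤ lsum xs (λ x → g x * g x) + lsum xs (λ _ → 1) * (y * y)
  cross-term [] g y = ≤-reflexive (cong (2 *_) (*-zeroʳ y))
  cross-term (x ∷ xs) g y = begin
      2 * (y * (a + S))                        ≡⟨ split y a S ⟩
      2 * (y * a) + 2 * (y * S)                ≤⟨ +-mono-≤ (am-gm y a) (cross-term xs g y) ⟩
      (y * y + a * a) + (Q + L * (y * y))      ≡⟨ regroup y a Q L ⟩
      (a * a + Q) + (1 + L) * (y * y)          ∎
    where
    open ≤-Reasoning
    a S Q L : ℕ
    a = g x
    S = lsum xs g
    Q = lsum xs (λ x → g x * g x)
    L = lsum xs (λ _ → 1)
    split : ∀ y a S → 2 * (y * (a + S)) ≡ 2 * (y * a) + 2 * (y * S)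
    split = solve-∀
    regroup : ∀ y a Q L → (y * y + a * a) + (Q + L * (y * y)) ≡ (a * a + Q) + (1 + L) * (y * y)
    regroup = solve-∀

  cauchy-schwarz : {A : Set} (xs : List A) (g : A → ℕ) →
    lsum xs g * lsum xs g ≤ lsum xs (λ _ → 1) * lsum xs (λ x → g x * g x)
  cauchy-schwarz [] g = z≤n
  cauchy-schwarz (x ∷ xs) g = begin
      (a + S) * (a + S)                        ≡⟨ square a S ⟩
      a * a + 2 * (a * S) + S * S              ≤⟨ +-mono-≤ (+-monoʳ-≤ (a * a) (cross-term xs g a)) (cauchy-schwarz xs g) ⟩
      a * a + (Q + L * (a * a)) + L * Q        ≡⟨ regroup a Q L ⟩
      (1 + L) * (a * a + Q)                    ∎
    where
    open ≤-Reasoning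
    a S Q L : ℕ
    a = g x
    S = lsum xs g
    Q = lsum xs (λ x → g x * g x)
    L = lsum xs (λ _ → 1)
    square : ∀ a S → (a + S) * (a + S) ≡ a * a + 2 * (a * S) + S * S
    square = solve-∀
    regroup : ∀ a Q L → a * a + (Q + L * (a * a)) + L * Q ≡ (1 + L) * (a * a + Q)
    regroup = solve-∀

-- Moments of the number of sets (from a family Nb) that miss a random t-subset X.
module SubsetMoments where

  open import Data.Nat
  open import Data.Nat.Properties
  open import Data.Bool using (Bool; true; false; not; _∧_; _∨_)
  open import Data.Fin using (Fin; zero; suc)
  open import Data.List using (List; []; _∷_; _++_; map)
  open import Data.List.Relation.Unary.All as All using (All; []; _∷_)
  import Data.List.Relation.Unary.All.Properties as AllP
  open import Relation.Binary.PropositionalEquality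
  open import Defs using (sumFin; count)
  open Binomial using (B)
  open FiniteSums

  Sub : ℕ → Set
  Sub n = Fin n → Bool

  cons : ∀ {n} → Bool → Sub n → Sub (suc n)
  cons b X zero = b
  cons b X (suc i) = X i

  subsets : (n t : ℕ) → List (Sub n)
  subsets zero zero = (λ ()) ∷ []
  subsets zero (suc t) = []
  subsets (suc n) zero = map (cons false) (subsets n zero)
  subsets (suc n) (suc t) = map (cons true) (subsets n t) ++ map (cons false) (subsets n (suc t))

  subsets-size : ∀ n t → All (λ X → count X ≡ t) (subsets n t)
  subsets-size zero zero = refl ∷ []
  subsets-size zero (suc t) = []
  subsets-size (suc n) zero = AllP.map⁺ (subsets-size n zero)
  subsets-size (suc n) (suc t) =
    AllP.++⁺ (AllP.map⁺ (All.map (cong suc) (subsets-size n t))) (AllP.map⁺ (subsets-size n (suc t)))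

  avoids : ∀ {n} → Sub n → Sub n → Bool
  avoids {zero} X A = true
  avoids {suc n} X A = not (X zero ∧ A zero) ∧ avoids (λ i → X (suc i)) (λ i → A (suc i))

  count-avoiding : ∀ n t (A : Sub n) → lsum (subsets n t) (λ X → ind (avoids X A)) ≡ B (n ∸ count A) t
  count-avoiding zero zero A = refl
  count-avoiding zero (suc t) A = refl
  count-avoiding (suc n) zero A =
    trans (lsum-map (cons false) (subsets n zero) _) (count-avoiding n zero (λ i → A (suc i)))
  count-avoiding (suc n) (suc t) A with A zero
  ... | true = trans (lsum-++ (map (cons true) (subsets n t)) _ _)
     (cong₂ _+_ (trans (lsum-map (cons true) (subsets n t) _) (lsum-zero (subsets n t)))
                (trans (lsum-map (cons false) (subsets n (suc t)) _) (count-avoiding n (suc t) A')))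
    where
    A' : Sub n
    A' = λ i → A (suc i)
  ... | false = trans (lsum-++ (map (cons true) (subsets n t)) _ _)
     (trans (cong₂ _+_ (trans (lsum-map (cons true) (subsets n t) _) (count-avoiding n t A'))
                       (trans (lsum-map (cons false) (subsets n (suc t)) _) (count-avoiding n (suc t) A')))
            (cong (λ m → B m (suc t)) (sym (+-∸-assoc 1 (count-≤ A')))))
    where
    A' : Sub n
    A' = λ i → A (suc i)

  avoids-nothing : ∀ {n} (X : Sub n) → avoids X (λ _ → false) ≡ true
  avoids-nothing {zero} X = refl
  avoids-nothing {suc n} X with X zero
  ... | true = avoids-nothing (λ i → X (suc i))
  ... | false = avoids-nothing (λ i → X (suc i))

  subsets-length : ∀ n t → lsum (subsets n t) (λ _ → 1) ≡ B n t
  subsets-length n t = trans (lsum-ext (subsets n t) (λ X → cong ind (sym (avoids-nothing X))))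
     (trans (count-avoiding n t (λ _ → false)) (cong (λ m → B (n ∸ m) t) (count-false n)))

  avoids-∨ : ∀ {n} (X A C : Sub n) → avoids X (λ w → A w ∨ C w) ≡ avoids X A ∧ avoids X C
  avoids-∨ {zero} X A C = refl
  avoids-∨ {suc n} X A C with X zero | A zero | C zero
  ... | false | a | c = avoids-∨ (λ i → X (suc i)) (λ i → A (suc i)) (λ i → C (suc i))
  ... | true | false | false = avoids-∨ (λ i → X (suc i)) (λ i → A (suc i)) (λ i → C (suc i))
  ... | true | true | c = refl
  ... | true | false | true = sym (∧-false (avoids (λ i → X (suc i)) (λ i → A (suc i))))
    where
    ∧-false : ∀ b → b ∧ false ≡ false
    ∧-false false = refl
    ∧-false true = refl

  ind-∧ : ∀ a b → ind (a ∧ b) ≡ ind a * ind b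
  ind-∧ false b = refl
  ind-∧ true false = refl
  ind-∧ true true = refl

  avoids-outside : ∀ {n} (X A : Sub n) (u : Fin n) → A u ≡ true → ind (avoids X A) ≤ ind (not (X u))
  avoids-outside {suc n} X A zero e with X zero | A zero
  ... | false | _ = ind≤1 (avoids (λ i → X (suc i)) (λ i → A (suc i)))
    where
    ind≤1 : ∀ b → ind b ≤ 1
    ind≤1 false = z≤n
    ind≤1 true = s≤s z≤n
  ... | true | true = z≤n
  avoids-outside {suc n} X A (suc u) e with X zero ∧ A zero
  ... | true = z≤n
  ... | false = avoids-outside (λ i → X (suc i)) (λ i → A (suc i)) u e

  module _ {n : ℕ} (Nb : Fin n → Sub n) where

    missed : Sub n → ℕ
    missed X = sumFin (λ u → ind (avoids X (Nb u)))

    first-moment : ∀ t → lsum (subsets n t) missed ≡ sumFin (λ u → B (n ∸ count (Nb u)) t)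
    first-moment t = trans (lsum-sumFin (subsets n t) (λ X u → ind (avoids X (Nb u))))
                           (sumFin-ext (λ u → count-avoiding n t (Nb u)))

    missed-squared : ∀ X → missed X * missed X ≡
      sumFin (λ u → sumFin (λ v → ind (avoids X (λ w → Nb u w ∨ Nb v w))))
    missed-squared X =
      trans (sumFin-*ʳ (missed X) (λ u → ind (avoids X (Nb u))))
            (sumFin-ext (λ u → trans (sumFin-*ˡ (ind (avoids X (Nb u))) (λ v → ind (avoids X (Nb v))))
               (sumFin-ext (λ v → trans (sym (ind-∧ (avoids X (Nb u)) (avoids X (Nb v))))
                                        (cong ind (sym (avoids-∨ X (Nb u) (Nb v))))))))

    second-moment : ∀ t → lsum (subsets n t) (λ X → missed X * missed X) ≡
      sumFin (λ u → sumFin (λ v → B (n ∸ count (λ w → Nb u w ∨ Nb v w)) t))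
    second-moment t =
      trans (lsum-ext (subsets n t) missed-squared)
        (trans (lsum-sumFin (subsets n t) (λ X u → sumFin (λ v → ind (avoids X (λ w → Nb u w ∨ Nb v w)))))
          (sumFin-ext (λ u → trans (lsum-sumFin (subsets n t) (λ X v → ind (avoids X (λ w → Nb u w ∨ Nb v w))))
            (sumFin-ext (λ v → count-avoiding n t (λ w → Nb u w ∨ Nb v w))))))

    -- If u ∈ Nb u for all u, then only vertices outside X can be counted: Y(X) ≤ n - |X|.
    missed-≤ : (∀ u → Nb u u ≡ true) → ∀ X → missed X ≤ n ∸ count X
    missed-≤ self X =
      ≤-trans (sumFin-mono (λ u → avoids-outside X (Nb u) u (self u)))
              (≤-reflexive (trans (sym (m+n∸m≡n (count X) _)) (cong (_∸ count X) (count-complement X))))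

    first-moment-bound : (∀ u → Nb u u ≡ true) → ∀ t → lsum (subsets n t) missed ≤ B n t * (n ∸ t)
    first-moment-bound self t = begin
       lsum (subsets n t) missed
         ≤⟨ lsum-mono (subsets n t) (All.map (λ {X} e → subst (λ s → missed X ≤ n ∸ s) e (missed-≤ self X))
                                             (subsets-size n t)) ⟩
       lsum (subsets n t) (λ _ → n ∸ t)
         ≡⟨ trans (lsum-const (subsets n t) (n ∸ t)) (cong (_* (n ∸ t)) (subsets-length n t)) ⟩
       B n t * (n ∸ t) ∎
      where open ≤-Reasoning

module NeighbourhoodCounts {n : ℕ} (G : Graph n) (t : ℕ) where

  open import Data.Nat
  open import Data.Nat.Properties
  open import Data.Nat.Tactic.RingSolver using (solve-∀)
  open import Data.Nat.Combinatorics using (_C_)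
  open import Data.Bool using (true; false; _∨_)
  open import Data.Fin using (Fin)
  open import Data.Fin.Properties using () renaming (_≟_ to _≟ᶠ_)
  open import Relation.Binary.PropositionalEquality
  open import Relation.Nullary using (does)
  open import Relation.Nullary.Decidable using (dec-true)
  open import Defs using (adj; irrefl; sumFin; sumPairs; count; deg; closedUnion; choose; _⊖ℕ_)
  open Binomial
  open FiniteSums
  open SubsetMoments

  N[_] : Fin n → Sub n
  N[ u ] w = does (w ≟ᶠ u) ∨ adj G u w

  u∈N[u] : ∀ u → N[ u ] u ≡ true
  u∈N[u] u = cong (_∨ adj G u u) (dec-true (u ≟ᶠ u) refl)

  |N[u]| : ∀ u → deg G u + 1 ≡ count N[ u ]
  |N[u]| u = trans (+-comm (deg G u) 1) (sym (count-insert u (adj G u) (irrefl G u)))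

  |N[u]∪N[v]| : ∀ u v → count (λ w → N[ u ] w ∨ N[ v ] w) ≡ closedUnion G u v
  |N[u]∪N[v]| u v = count-ext (λ w → reassociate (does (w ≟ᶠ u)) (adj G u w) (does (w ≟ᶠ v)) (adj G v w))
    where
    reassociate : ∀ a b c d → (a ∨ b) ∨ (c ∨ d) ≡ a ∨ (c ∨ (b ∨ d))
    reassociate true b c d = refl
    reassociate false true true d = refl
    reassociate false true false d = refl
    reassociate false false true d = refl
    reassociate false false false d = refl

  closedUnion-≤ : ∀ u v → closedUnion G u v ≤ deg G u + deg G v + 2
  closedUnion-≤ u v = begin
      closedUnion G u v
        ≤⟨ count-∨ (λ w → does (w ≟ᶠ u)) _ ⟩
      count (λ w → does (w ≟ᶠ u)) + count (λ w → does (w ≟ᶠ v) ∨ adj G u w ∨ adj G v w)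
        ≤⟨ +-mono-≤ (≤-reflexive (count-singleton u)) (count-∨ (λ w → does (w ≟ᶠ v)) _) ⟩
      1 + (count (λ w → does (w ≟ᶠ v)) + count (λ w → adj G u w ∨ adj G v w))
        ≤⟨ +-monoʳ-≤ 1 (+-mono-≤ (≤-reflexive (count-singleton v)) (count-∨ (adj G u) (adj G v))) ⟩
      1 + (1 + (deg G u + deg G v))
        ≡⟨ regroup (deg G u) (deg G v) ⟩
      deg G u + deg G v + 2 ∎
    where
    open ≤-Reasoning
    regroup : ∀ a b → 1 + (1 + (a + b)) ≡ a + b + 2
    regroup = solve-∀

  -- The numerators of a, b and c (before division by C(n,t)).
  σ₁ σb σc : ℕ
  σ₁ = sumFin (λ u → choose (n ⊖ℕ (deg G u + 1)) t)
  σb = sumPairs (λ u v → choose (n ⊖ℕ closedUnion G u v) t)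
  σc = sumPairs (λ u v → choose (n ⊖ℕ (deg G u + deg G v + 2)) t)

  private
    missedPair : Fin n → Fin n → ℕ
    missedPair u v = B (n ∸ count (λ w → N[ u ] w ∨ N[ v ] w)) t

    σ₁≡ : σ₁ ≡ lsum (subsets n t) (missed N[_])
    σ₁≡ = trans (sumFin-ext (λ u → trans (cong (λ k → choose (n ⊖ℕ k) t) (|N[u]| u))
                                         (choose-≥ n _ t (count-≤ N[ u ]))))
                (sym (first-moment N[_] t))

    σb≡ : σb ≡ sumPairs missedPair
    σb≡ = sumPairs-ext (λ u v _ → trans (cong (λ k → choose (n ⊖ℕ k) t) (sym (|N[u]∪N[v]| u v)))
                                        (choose-≥ n _ t (count-≤ (λ w → N[ u ] w ∨ N[ v ] w))))

    missedPair-sym : ∀ u v → missedPair u v ≡ missedPair v u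
    missedPair-sym u v = cong (λ k → B (n ∸ k) t) (count-ext (λ w → ∨-comm (N[ u ] w) (N[ v ] w)))
      where open import Data.Bool.Properties using (∨-comm)

    missedPair-diag : ∀ u → missedPair u u ≡ B (n ∸ count N[ u ]) t
    missedPair-diag u = cong (λ k → B (n ∸ k) t) (count-ext (λ w → ∨-idem (N[ u ] w)))
      where open import Data.Bool.Properties using (∨-idem)

    σ₁+2σb≡ : σ₁ + 2 * σb ≡ lsum (subsets n t) (λ X → missed N[_] X * missed N[_] X)
    σ₁+2σb≡ = sym (begin
      lsum (subsets n t) (λ X → missed N[_] X * missed N[_] X)
        ≡⟨ second-moment N[_] t ⟩
      sumFin (λ u → sumFin (λ v → missedPair u v))
        ≡⟨ double-sum-symmetric missedPair missedPair-sym ⟩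
      sumFin (λ u → missedPair u u) + 2 * sumPairs missedPair
        ≡⟨ cong₂ _+_ (trans (sumFin-ext missedPair-diag) (trans (sym (first-moment N[_] t)) (sym σ₁≡)))
                     (cong (2 *_) (sym σb≡)) ⟩
      σ₁ + 2 * σb ∎)
      where open ≡-Reasoning

  -- E[Y]² ≤ E[Y²], cleared of denominators.
  variance-nonneg : σ₁ * σ₁ ≤ (n C t) * (σ₁ + 2 * σb)
  variance-nonneg =
    subst₂ _≤_ (sym (cong₂ _*_ σ₁≡ σ₁≡))
           (cong₂ _*_ (trans (subsets-length n t) (B≡C n t)) (sym σ₁+2σb≡))
           (cauchy-schwarz (subsets n t) (missed N[_]))
    where open CauchySchwarz using (cauchy-schwarz)

  -- E[Y] ≤ n - t, cleared of denominators.
  mean-≤ : σ₁ ≤ (n C t) * (n ∸ t)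
  mean-≤ = subst₂ _≤_ (sym σ₁≡) (cong (_* (n ∸ t)) (B≡C n t)) (first-moment-bound N[_] u∈N[u] t)

  σc≤σb : σc ≤ σb
  σc≤σb = sumPairs-mono (λ u v → choose-antitone n t (closedUnion-≤ u v))

module RationalFacts where

  open import Data.Nat as ℕ using (ℕ; zero; suc)
  import Data.Nat.Properties as ℕP
  open import Data.Integer as ℤ using (-[1+_]) renaming (+_ to ipos)
  import Data.Integer.Properties as ℤP
  open import Data.Rational
  open import Data.Rational.Properties
  import Data.Rational.Unnormalised as U
  import Data.Rational.Unnormalised.Properties as UP
  open import Data.Rational.Solver using (module +-*-Solver)
  open import Data.Nat.Coprimality using (1-coprimeTo) renaming (sym to coprime-sym)
  open import Data.Product using (Σ; _,_)
  open import Data.Empty using (⊥-elim)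
  open import Relation.Binary.PropositionalEquality
  open import Defs using (ℕtoℚ; _÷ᵗ_)
  open +-*-Solver

  private
    ℕtoℚ-mk : ∀ k → ℕtoℚ k ≡ mkℚ (ipos k) 0 (coprime-sym (1-coprimeTo k))
    ℕtoℚ-mk k = ↥p/↧p≡p (mkℚ (ipos k) 0 (coprime-sym (1-coprimeTo k)))

  ℕtoℚ-+ : ∀ a b → ℕtoℚ (a ℕ.+ b) ≡ ℕtoℚ a + ℕtoℚ b
  ℕtoℚ-+ a b = toℚᵘ-injective (UP.≃-trans embed (UP.≃-sym (toℚᵘ-homo-+ (ℕtoℚ a) (ℕtoℚ b))))
    where
    embed : toℚᵘ (ℕtoℚ (a ℕ.+ b)) U.≃ (toℚᵘ (ℕtoℚ a) U.+ toℚᵘ (ℕtoℚ b))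
    embed rewrite ℕtoℚ-mk (a ℕ.+ b) | ℕtoℚ-mk a | ℕtoℚ-mk b =
      U.*≡* (trans (ℤP.*-identityʳ _) (sym (trans (ℤP.*-identityʳ _)
        (trans (cong₂ ℤ._+_ (ℤP.*-identityʳ (ipos a)) (ℤP.*-identityʳ (ipos b))) (sym (ℤP.pos-+ a b))))))

  ℕtoℚ-* : ∀ a b → ℕtoℚ (a ℕ.* b) ≡ ℕtoℚ a * ℕtoℚ b
  ℕtoℚ-* a b = toℚᵘ-injective (UP.≃-trans embed (UP.≃-sym (toℚᵘ-homo-* (ℕtoℚ a) (ℕtoℚ b))))
    where
    embed : toℚᵘ (ℕtoℚ (a ℕ.* b)) U.≃ (toℚᵘ (ℕtoℚ a) U.* toℚᵘ (ℕtoℚ b))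
    embed rewrite ℕtoℚ-mk (a ℕ.* b) | ℕtoℚ-mk a | ℕtoℚ-mk b =
      U.*≡* (trans (ℤP.*-identityʳ _) (sym (trans (ℤP.*-identityʳ _) (sym (ℤP.pos-* a b)))))

  ℕtoℚ-suc : ∀ m → ℕtoℚ (suc m) ≡ 1ℚ + ℕtoℚ m
  ℕtoℚ-suc m = ℕtoℚ-+ 1 m

  ℕtoℚ-mono-≤ : ∀ {a b} → a ℕ.≤ b → ℕtoℚ a ≤ ℕtoℚ b
  ℕtoℚ-mono-≤ {a} {b} p rewrite ℕtoℚ-mk a | ℕtoℚ-mk b =
    *≤* (subst₂ ℤ._≤_ (sym (ℤP.*-identityʳ (ipos a))) (sym (ℤP.*-identityʳ (ipos b))) (ℤ.+≤+ p))

  ℕtoℚ-mono-< : ∀ {a b} → a ℕ.< b → ℕtoℚ a < ℕtoℚ b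
  ℕtoℚ-mono-< {a} {b} p rewrite ℕtoℚ-mk a | ℕtoℚ-mk b =
    *<* (subst₂ ℤ._<_ (sym (ℤP.*-identityʳ (ipos a))) (sym (ℤP.*-identityʳ (ipos b))) (ℤ.+<+ p))

  ℕtoℚ-nonneg : ∀ a → 0ℚ ≤ ℕtoℚ a
  ℕtoℚ-nonneg a = ℕtoℚ-mono-≤ {0} {a} ℕ.z≤n

  -- recip k = 1/(k+1).
  recip : ℕ → ℚ
  recip k = mkℚ (ipos 1) k (1-coprimeTo (suc k))

  recip-nonneg : ∀ k → 0ℚ ≤ recip k
  recip-nonneg k = nonNegative⁻¹ (recip k)

  recip-inverse : ∀ k → ℕtoℚ (suc k) * recip k ≡ 1ℚ
  recip-inverse k rewrite ℕtoℚ-mk (suc k) = *-inverseʳ (mkℚ (ipos (suc k)) 0 (coprime-sym (1-coprimeTo (suc k))))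

  ÷ᵗ-suc : ∀ x k → x ÷ᵗ ℕtoℚ (suc k) ≡ x * recip k
  ÷ᵗ-suc x k rewrite ℕtoℚ-mk (suc k) = refl

  recip-below : ∀ ε → 0ℚ < ε → Σ ℕ λ d → recip d ≤ ε
  recip-below (mkℚ (ipos (suc p)) d _) _ = d , *≤* (ℤ.+≤+ (ℕ.s≤s (ℕP.+-monoʳ-≤ d ℕ.z≤n)))
  recip-below ε@(mkℚ (ipos zero) _ _) lt = ⊥-elim (<-irrefl (sym (↥p≡0⇒p≡0 ε refl)) lt)
  recip-below (mkℚ -[1+ _ ] _ _) lt with positive lt
  ... | ()

  0≤q-p : ∀ {p q} → p ≤ q → 0ℚ ≤ q - p
  0≤q-p {p} {q} le = subst (_≤ q - p) (+-inverseʳ p) (+-monoˡ-≤ (- p) le)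

  p-q≤p : ∀ p {q} → 0ℚ ≤ q → p - q ≤ p
  p-q≤p p h = subst (p - _ ≤_) (+-identityʳ p) (+-monoʳ-≤ p (neg-antimono-≤ h))

  p-antitone : ∀ p {q r} → q ≤ r → p - r ≤ p - q
  p-antitone p h = +-monoʳ-≤ p (neg-antimono-≤ h)

  *-nonneg : ∀ {x y} → 0ℚ ≤ x → 0ℚ ≤ y → 0ℚ ≤ x * y
  *-nonneg {x} px py = subst (_≤ x * _) (*-zeroʳ x) (*-monoˡ-≤-nonNeg x {{nonNegative px}} py)

  *-pos : ∀ {x y} → 0ℚ < x → 0ℚ < y → 0ℚ < x * y
  *-pos {x} {y} px py = subst (_< x * y) (*-zeroˡ y) (*-monoˡ-<-pos y {{positive py}} px)

  ≤-*ʳ : ∀ {p q} r → 0ℚ ≤ r → p ≤ q → p * r ≤ q * r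
  ≤-*ʳ r h le = *-monoʳ-≤-nonNeg r {{nonNegative h}} le

  ≤-*ˡ : ∀ {p q} r → 0ℚ ≤ r → p ≤ q → r * p ≤ r * q
  ≤-*ˡ r h le = *-monoˡ-≤-nonNeg r {{nonNegative h}} le

  ÷ᵗ-nonneg : ∀ V D → 0ℚ ≤ V → 0ℚ ≤ D → 0ℚ ≤ V ÷ᵗ D
  ÷ᵗ-nonneg V (mkℚ (ipos zero) _ _) hv hd = ≤-refl
  ÷ᵗ-nonneg V D@(mkℚ (ipos (suc _)) _ _) hv hd = *-nonneg hv (nonNegative⁻¹ (1/ D))
  ÷ᵗ-nonneg V (mkℚ -[1+ _ ] _ _) hv (*≤* ())

  ÷ᵗ-monoˡ : ∀ V W D → V ≤ W → 0ℚ ≤ D → V ÷ᵗ D ≤ W ÷ᵗ D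
  ÷ᵗ-monoˡ V W (mkℚ (ipos zero) _ _) le hd = ≤-refl
  ÷ᵗ-monoˡ V W D@(mkℚ (ipos (suc _)) _ _) le hd = ≤-*ʳ (1/ D) (nonNegative⁻¹ (1/ D)) le
  ÷ᵗ-monoˡ V W (mkℚ -[1+ _ ] _ _) le (*≤* ())

  ÷ᵗ-cancel : ∀ D W → 0ℚ < D → (D * W) ÷ᵗ D ≡ W
  ÷ᵗ-cancel D@(mkℚ (ipos zero) _ _) W lt = ⊥-elim (<-irrefl (sym (↥p≡0⇒p≡0 D refl)) lt)
  ÷ᵗ-cancel D@(mkℚ (ipos (suc _)) _ _) W lt =
    trans (solve 3 (λ x y z → (x :* y) :* z := y :* (x :* z)) refl D W (1/ D))
          (trans (cong (W *_) (*-inverseʳ D)) (*-identityʳ W))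
  ÷ᵗ-cancel (mkℚ -[1+ _ ] _ _) W lt with positive lt
  ... | ()

  ÷ᵗ-< : ∀ h ε g → 0ℚ < g → h < ε * g → h ÷ᵗ g < ε
  ÷ᵗ-< h ε g@(mkℚ (ipos zero) _ _) lt _ = ⊥-elim (<-irrefl (sym (↥p≡0⇒p≡0 g refl)) lt)
  ÷ᵗ-< h ε g@(mkℚ (ipos (suc _)) _ _) lt hl =
    subst (h * 1/ g <_) (trans (*-assoc ε g (1/ g)) (trans (cong (ε *_) (*-inverseʳ g)) (*-identityʳ ε)))
          (*-monoˡ-<-pos (1/ g) hl)
  ÷ᵗ-< h ε (mkℚ -[1+ _ ] _ _) lt _ with positive lt
  ... | ()

-- The quantities a, b and the HM1 term, in terms of abstract numerators σ₁, σb
-- and the common denominator N (instantiated with N = C(n,t)).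
module Terms (σ₁ σb N n t : ℕ) where

  open import Data.Rational using (ℚ; _+_; _-_; _*_)
  open import Defs using (ℕtoℚ; _÷ᵗ_)

  S a b hm1 : ℚ
  S = ℕtoℚ σ₁ ÷ᵗ ℕtoℚ N
  a = ℕtoℚ t + S
  b = S + ℕtoℚ 2 * (ℕtoℚ σb ÷ᵗ ℕtoℚ N)
  hm1 = a - (b - (a - ℕtoℚ t) * (a - ℕtoℚ t)) ÷ᵗ (ℕtoℚ n - a)

-- Part (1) for a single t: the HM1 term lies below a and below the HM2 term,
-- given the three counting facts (stated abstractly for N = C(n,t) > 0).
module HM1Comparison (σ₁ σb σc N k n t : ℕ) (N≡ : N ≡ ℕ.suc k)
  (variance-nonneg : σ₁ ℕ.* σ₁ ℕ.≤ N ℕ.* (σ₁ ℕ.+ 2 ℕ.* σb))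
  (mean-≤ : σ₁ ℕ.≤ N ℕ.* (n ℕ.∸ t)) (t≤n : t ℕ.≤ n) (σc≤σb : σc ℕ.≤ σb) where

  import Data.Nat.Properties as ℕP
  open import Data.Rational
  open import Data.Rational.Properties
  open import Data.Rational.Solver using (module +-*-Solver)
  open import Relation.Binary.PropositionalEquality
  open import Defs using (ℕtoℚ; _÷ᵗ_)
  open RationalFacts
  open +-*-Solver
  open Terms σ₁ σb N n t public

  c hm2 : ℚ
  c = S + ℕtoℚ 2 * (ℕtoℚ σc ÷ᵗ ℕtoℚ N)
  hm2 = a - (c - (a - ℕtoℚ t) * (a - ℕtoℚ t)) ÷ᵗ (ℕtoℚ n - a)

  private
    r s' P' N' t' two : ℚ
    r = recip k
    s' = ℕtoℚ σ₁
    P' = ℕtoℚ σb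
    N' = ℕtoℚ N
    t' = ℕtoℚ t
    two = ℕtoℚ 2

    ÷N : ∀ x → x ÷ᵗ N' ≡ x * r
    ÷N x rewrite N≡ = ÷ᵗ-suc x k

    N*r : N' * r ≡ 1ℚ
    N*r rewrite N≡ = recip-inverse k

    a-t≡S : a - t' ≡ S
    a-t≡S = solve 2 (λ x y → (x :+ y) :- x := y) refl t' S

  -- The denominator n - a is non-negative, because S ≤ n - t.
  denominator-nonneg : 0ℚ ≤ ℕtoℚ n - a
  denominator-nonneg = 0≤q-p (subst (a ≤_) n≡ (+-monoʳ-≤ t' S≤m))
    where
    m : ℕ
    m = n ℕ.∸ t
    n≡ : t' + ℕtoℚ m ≡ ℕtoℚ n
    n≡ = trans (sym (ℕtoℚ-+ t m)) (cong ℕtoℚ (ℕP.m+[n∸m]≡n t≤n))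
    S≤m : S ≤ ℕtoℚ m
    S≤m = begin
      S                   ≡⟨ ÷N s' ⟩
      s' * r              ≤⟨ ≤-*ʳ r (recip-nonneg k) (subst (s' ≤_) (ℕtoℚ-* N m) (ℕtoℚ-mono-≤ mean-≤)) ⟩
      N' * ℕtoℚ m * r     ≡⟨ solve 3 (λ x y z → x :* y :* z := y :* (x :* z)) refl N' (ℕtoℚ m) r ⟩
      ℕtoℚ m * (N' * r)   ≡⟨ cong (ℕtoℚ m *_) N*r ⟩
      ℕtoℚ m * 1ℚ         ≡⟨ *-identityʳ _ ⟩
      ℕtoℚ m              ∎
      where open ≤-Reasoning

  -- The numerator b - S² equals (N(σ₁ + 2σb) - σ₁²)/N², hence is non-negative.
  numerator-nonneg : 0ℚ ≤ b - S * S
  numerator-nonneg = subst (0ℚ ≤_) (sym b-S²≡) (*-nonneg (*-nonneg (recip-nonneg k) (recip-nonneg k)) W≥0)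
    where
    W : ℚ
    W = N' * (s' + two * P') - s' * s'
    W≥0 : 0ℚ ≤ W
    W≥0 = 0≤q-p (subst₂ _≤_ (ℕtoℚ-* σ₁ σ₁)
             (trans (ℕtoℚ-* N (σ₁ ℕ.+ 2 ℕ.* σb))
                    (cong (N' *_) (trans (ℕtoℚ-+ σ₁ (2 ℕ.* σb)) (cong (s' +_) (ℕtoℚ-* 2 σb)))))
             (ℕtoℚ-mono-≤ variance-nonneg))
    b-S²≡ : b - S * S ≡ r * r * W
    b-S²≡ = begin
       b - S * S
         ≡⟨ cong₂ (λ x y → x + two * y - x * x) (÷N s') (÷N P') ⟩
       s' * r + two * (P' * r) - s' * r * (s' * r)
         ≡⟨ solve 4 (λ x y z w → x :* z :+ w :* (y :* z) :- x :* z :* (x :* z)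
                       := z :* con 1ℚ :* (x :+ w :* y) :- x :* z :* (x :* z)) refl s' P' r two ⟩
       r * 1ℚ * (s' + two * P') - s' * r * (s' * r)
         ≡⟨ cong (λ z → r * z * (s' + two * P') - s' * r * (s' * r)) (sym N*r) ⟩
       r * (N' * r) * (s' + two * P') - s' * r * (s' * r)
         ≡⟨ solve 5 (λ x y z w u → z :* (u :* z) :* (x :+ w :* y) :- x :* z :* (x :* z)
                       := z :* z :* (u :* (x :+ w :* y) :- x :* x)) refl s' P' r two N' ⟩
       r * r * W ∎
      where open ≡-Reasoning

  hm1≤a : hm1 ≤ a
  hm1≤a = subst (λ z → a - (b - z * z) ÷ᵗ (ℕtoℚ n - a) ≤ a) (sym a-t≡S)
            (p-q≤p a (÷ᵗ-nonneg _ _ numerator-nonneg denominator-nonneg))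

  c≤b : c ≤ b
  c≤b = +-monoʳ-≤ S (≤-*ˡ two (ℕtoℚ-nonneg 2)
          (subst₂ _≤_ (sym (÷N (ℕtoℚ σc))) (sym (÷N P')) (≤-*ʳ r (recip-nonneg k) (ℕtoℚ-mono-≤ σc≤σb))))

  hm1≤hm2 : hm1 ≤ hm2
  hm1≤hm2 = subst (λ z → a - (b - z * z) ÷ᵗ (ℕtoℚ n - a) ≤ a - (c - z * z) ÷ᵗ (ℕtoℚ n - a)) (sym a-t≡S)
              (p-antitone a (÷ᵗ-monoˡ _ _ _ (+-monoˡ-≤ (- (S * S)) c≤b) denominator-nonneg))

module MinOverRange where

  open import Data.Nat as ℕ using (ℕ; zero; suc; z≤n; s≤s)
  import Data.Nat.Properties as ℕP
  open import Data.Rational using (ℚ; _≤_)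
  open import Data.Rational.Properties using (≤-refl; ≤-trans; ⊓-mono-≤; ⊓-glb; p⊓q≤p; p⊓q≤q)
  open import Relation.Binary.PropositionalEquality using (subst)
  open import Relation.Nullary using (yes; no)
  open import Defs using (minRange)

  minRange-mono : ∀ (f g : ℕ → ℚ) m → (∀ t → 1 ℕ.≤ t → t ℕ.≤ m → f t ≤ g t) → 1 ℕ.≤ m →
    ∀ K → K ℕ.≤ m → minRange f K ≤ minRange g K
  minRange-mono f g m f≤g 1≤m zero _ = f≤g 1 ℕP.≤-refl 1≤m
  minRange-mono f g m f≤g 1≤m (suc zero) _ = f≤g 1 ℕP.≤-refl 1≤m
  minRange-mono f g m f≤g 1≤m (suc (suc K)) K≤m =
    ⊓-mono-≤ (minRange-mono f g m f≤g 1≤m (suc K) (ℕP.≤-trans (ℕP.n≤1+n _) K≤m)) (f≤g (suc (suc K)) (s≤s z≤n) K≤m)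

  minRange-≤ : ∀ (f : ℕ → ℚ) K t → 1 ℕ.≤ t → t ℕ.≤ K → minRange f K ≤ f t
  minRange-≤ f zero (suc t) _ ()
  minRange-≤ f (suc K) t = below-suc K t
    where
    below-suc : ∀ K t → 1 ℕ.≤ t → t ℕ.≤ suc K → minRange f (suc K) ≤ f t
    below-suc zero (suc zero) _ _ = ≤-refl
    below-suc zero (suc (suc t)) _ (s≤s ())
    below-suc (suc K) t 1≤t t≤K with t ℕP.≤? suc K
    ... | yes t≤ = ≤-trans (p⊓q≤p (minRange f (suc K)) _) (below-suc K t 1≤t t≤)
    ... | no t≰ = subst (λ u → minRange f (suc (suc K)) ≤ f u) (ℕP.≤-antisym (ℕP.≰⇒> t≰) t≤K)
                        (p⊓q≤q (minRange f (suc K)) _)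

  minRange-glb : ∀ (f : ℕ → ℚ) K c → (∀ t → 1 ℕ.≤ t → t ℕ.≤ K → c ≤ f t) → 1 ℕ.≤ K → c ≤ minRange f K
  minRange-glb f (suc zero) c below _ = below 1 ℕP.≤-refl ℕP.≤-refl
  minRange-glb f (suc (suc K)) c below _ =
    ⊓-glb (minRange-glb f (suc K) c (λ t p q → below t p (ℕP.m≤n⇒m≤1+n q)) (s≤s z≤n))
          (below (suc (suc K)) (s≤s z≤n) ℕP.≤-refl)

module Part1 where

  open import Data.Nat as ℕ using (ℕ; _∸_; z≤n; s≤s)
  import Data.Nat.Properties as ℕP
  open import Data.Nat.Combinatorics using (_C_)
  open import Data.Fin using (Fin)
  open import Data.Product using (_×_; _,_; proj₁; proj₂)
  open import Data.Rational using () renaming (_≤_ to _≤ℚ_)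
  open import Relation.Binary.PropositionalEquality
  open import Defs hiding (sym)
  open MinOverRange using (minRange-mono)

  hm1-pointwise : ∀ {n} (G : Graph n) t → t ℕ.≤ n → (hm1Term G t ≤ℚ aG G t) × (hm1Term G t ≤ℚ hm2Term G t)
  hm1-pointwise {n} G t t≤n = Cmp.hm1≤a , Cmp.hm1≤hm2
    where
    open NeighbourhoodCounts G t
    C-pos : 0 ℕ.< n C t
    C-pos = subst (0 ℕ.<_) (Binomial.B≡C n t) (Binomial.B-pos n t t≤n)
    module Cmp = HM1Comparison σ₁ σb σc (n C t) (ℕ.pred (n C t)) n t
      (sym (ℕP.suc-pred (n C t) {{ℕ.>-nonZero C-pos}})) variance-nonneg mean-≤ t≤n σc≤σb

  -- The minima are over t ∈ {1,…,n - δ} ⊆ {1,…,n}, and n ≥ 1 since G has a vertex.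
  part1 : (n : ℕ) (G : Graph n) → InΓ G → (γHM1 G ≤ℚ γCSSF G) × (γHM1 G ≤ℚ γHM2 G)
  part1 n G (_ , (u , _)) =
      minRange-mono _ _ n (λ t _ t≤n → proj₁ (hm1-pointwise G t t≤n)) (1≤n u) (n ∸ δ G) (ℕP.m∸n≤m n (δ G))
    , minRange-mono _ _ n (λ t _ t≤n → proj₂ (hm1-pointwise G t t≤n)) (1≤n u) (n ∸ δ G) (ℕP.m∸n≤m n (δ G))
    where
    1≤n : ∀ {m} → Fin m → 1 ℕ.≤ m
    1≤n Fin.zero = s≤s z≤n
    1≤n (Fin.suc _) = s≤s z≤n

-- The star K₁,L on Fin (L + 1): centre zero, leaves suc i.
module StarGraph where

  open import Data.Nat
  open import Data.Nat.Properties
  open import Data.Bool using (Bool; true; false; _∨_)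
  open import Data.Fin using (Fin; zero; suc; toℕ)
  open import Data.Fin.Properties using () renaming (_≟_ to _≟ᶠ_)
  import Data.Integer.Properties as ℤP
  open import Data.Product using (_,_)
  open import Relation.Nullary using (does; ¬_; yes; no)
  open import Relation.Binary.PropositionalEquality
  open import Data.Empty using (⊥-elim)
  open import Defs hiding (sym)
  open Binomial
  open FiniteSums

  starAdj : ∀ {L} → Fin (suc L) → Fin (suc L) → Bool
  starAdj zero zero = false
  starAdj zero (suc _) = true
  starAdj (suc _) zero = true
  starAdj (suc _) (suc _) = false

  Star : ∀ L → Graph (suc L)
  Star L = record { adj = starAdj ; sym = symmetric ; irrefl = irreflexive }
    where
    symmetric : ∀ u v → starAdj u v ≡ starAdj v u
    symmetric zero zero = refl
    symmetric zero (suc _) = refl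
    symmetric (suc _) zero = refl
    symmetric (suc _) (suc _) = refl
    irreflexive : ∀ u → starAdj u u ≡ false
    irreflexive zero = refl
    irreflexive (suc _) = refl

  Star-InΓ : ∀ L → InΓ (Star (suc (suc L)))
  Star-InΓ L = connected , (suc zero , suc (suc zero) , (λ ()) , refl)
    where
    from-centre : ∀ v → Reach (Star (suc (suc L))) zero v
    from-centre zero = here
    from-centre (suc v) = step refl here
    connected : Connected (Star (suc (suc L)))
    connected zero v = from-centre v
    connected (suc u) v = step refl (from-centre v)

  minFin-glb : ∀ {m} b (f : Fin m → ℕ) {c} → (∀ i → c ≤ f i) → c ≤ b → c ≤ minFin b f
  minFin-glb {zero} b f below hb = hb
  minFin-glb {suc m} b f below hb = ⊓-glb (below zero) (minFin-glb b (λ i → f (suc i)) (λ i → below (suc i)) hb)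

  module Counts (L : ℕ) where

    G : Graph (suc L)
    G = Star L

    deg-centre : deg G zero ≡ L
    deg-centre = count-true (λ i → true) (λ _ → refl)

    deg-leaf : ∀ i → deg G (suc i) ≡ 1
    deg-leaf i = cong suc (count-false L)

    δ-star : 1 ≤ L → δ G ≡ 1
    δ-star 1≤L = trans (cong (_⊓ minFin (suc L) (λ i → deg G (suc i))) deg-centre)
        (trans (cong (L ⊓_) (≤-antisym (leaves≤1 1≤L) (minFin-glb (suc L) _ (λ i → ≤-reflexive (sym (deg-leaf i))) (s≤s z≤n))))
               (m≥n⇒m⊓n≡n 1≤L))
      where
      leaves≤1 : 1 ≤ L → minFin (suc L) (λ i → deg G (suc i)) ≤ 1
      leaves≤1 (s≤s _) = subst (λ x → x ⊓ minFin (suc L) (λ i → deg G (suc (suc i))) ≤ 1)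
                               (sym (deg-leaf zero)) (m⊓n≤m 1 _)

    open NeighbourhoodCounts G using (σ₁; σb)

    -- Only leaves contribute to σ₁, each with C(L-1, t).
    σ₁-star : ∀ t → 1 ≤ t → 1 ≤ L → σ₁ t ≡ L * B (L ∸ 1) t
    σ₁-star (suc t) _ 1≤L = trans (cong₂ _+_ centre (sumFin-ext leaf)) (sumFin-const {L} (B (L ∸ 1) (suc t)))
      where
      centre : choose (suc L ⊖ℕ (deg G zero + 1)) (suc t) ≡ 0
      centre rewrite deg-centre | +-comm L 1 | ℤP.n⊖n≡0 (suc L) = refl
      leaf : ∀ i → choose (suc L ⊖ℕ (deg G (suc i) + 1)) (suc t) ≡ B (L ∸ 1) (suc t)
      leaf i = trans (cong (λ d → choose (suc L ⊖ℕ (d + 1)) (suc t)) (deg-leaf i))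
                     (choose-≥ (suc L) 2 (suc t) (s≤s 1≤L))

    closedUnion-centre : ∀ v → closedUnion G zero (suc v) ≡ suc L
    closedUnion-centre v = count-true _ covers
      where
      covers : ∀ w → (does (w ≟ᶠ zero) ∨ does (w ≟ᶠ suc v) ∨ starAdj zero w ∨ starAdj (suc v) w) ≡ true
      covers zero = refl
      covers (suc w) with does (w ≟ᶠ v)
      ... | true = refl
      ... | false = refl

    closedUnion-leaves : ∀ i j → ¬ (i ≡ j) → closedUnion G (suc i) (suc j) ≡ 3
    closedUnion-leaves i j i≢j =
      cong suc (trans (count-insert i p p-i) (cong suc (trans (count-ext (λ w → ∨-false (does (w ≟ᶠ j)))) (count-singleton j))))
      where
      p : Fin L → Bool
      p w = does (w ≟ᶠ j) ∨ (false ∨ false)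
      ∨-false : ∀ b → b ∨ (false ∨ false) ≡ b
      ∨-false true = refl
      ∨-false false = refl
      p-i : p i ≡ false
      p-i with i ≟ᶠ j
      ... | yes e = ⊥-elim (i≢j e)
      ... | no _ = refl

    -- Pairs containing the centre contribute 0, pairs of leaves C(L-2, t) each,
    -- so 2σb + L·C(L-2,t) = L²·C(L-2,t).
    σb-star : ∀ t → 1 ≤ t → 2 ≤ L → 2 * σb t + L * B (L ∸ 2) t ≡ L * (L * B (L ∸ 2) t)
    σb-star (suc t) _ 2≤L = begin
        2 * σb (suc t) + L * c
          ≡⟨ cong (λ z → 2 * z + L * c) (cong₂ _+_ (trans (sumFin-ext via-centre) (sumFin-const {L} 0))
                                                 (sumPairs-ext between-leaves)) ⟩
        2 * (L * 0 + sumPairs {L} (λ _ _ → c)) + L * c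
          ≡⟨ cong (λ z → 2 * (z + sumPairs {L} (λ _ _ → c)) + L * c) (*-zeroʳ L) ⟩
        2 * sumPairs {L} (λ _ _ → c) + L * c
          ≡⟨ +-comm _ (L * c) ⟩
        L * c + 2 * sumPairs {L} (λ _ _ → c)
          ≡⟨ cong (_+ 2 * sumPairs {L} (λ _ _ → c)) (sym (sumFin-const {L} c)) ⟩
        sumFin {L} (λ _ → c) + 2 * sumPairs {L} (λ _ _ → c)
          ≡⟨ sym (double-sum-symmetric {L} (λ _ _ → c) (λ _ _ → refl)) ⟩
        sumFin {L} (λ _ → sumFin {L} (λ _ → c))
          ≡⟨ trans (sumFin-ext {L} (λ _ → sumFin-const {L} c)) (sumFin-const {L} (L * c)) ⟩
        L * (L * c) ∎
      where
      open ≡-Reasoning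
      c : ℕ
      c = B (L ∸ 2) (suc t)
      via-centre : ∀ v → choose (suc L ⊖ℕ closedUnion G zero (suc v)) (suc t) ≡ 0
      via-centre v = trans (cong (λ k → choose (suc L ⊖ℕ k) (suc t)) (closedUnion-centre v))
                           (cong (λ z → choose z (suc t)) (ℤP.n⊖n≡0 (suc L)))
      between-leaves : ∀ u v → toℕ u < toℕ v → choose (suc L ⊖ℕ closedUnion G (suc u) (suc v)) (suc t) ≡ c
      between-leaves u v lt = trans (cong (λ k → choose (suc L ⊖ℕ k) (suc t)) (closedUnion-leaves u v (λ e → <-irrefl (cong toℕ e) lt)))
                                    (choose-≥ (suc L) 3 (suc t) (s≤s 2≤L))

-- For the star, the counts satisfy  σ₁·n = j(j+1)·N  and  2σb + σ₁ = j·σ₁,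
-- where n = t + j + 1.  From these, with N = C(n,t), the terms take the closed
-- forms  S = j(j+1)/n,  b = j·S,  n - a = (j+1)(t+1)/n  and  HM1 = t + j/(t+1).
module StarClosedForm (σ₁ σb N k n t j : ℕ) (N≡ : N ≡ ℕ.suc k) (n≡ : n ≡ ℕ.suc (t ℕ.+ j))
  (first : σ₁ ℕ.* n ≡ j ℕ.* ℕ.suc j ℕ.* N) (second : 2 ℕ.* σb ℕ.+ σ₁ ≡ j ℕ.* σ₁) where

  open import Data.Nat as ℕ using (suc)
  import Data.Nat.Properties as ℕP
  open import Data.Nat.Tactic.RingSolver using (solve-∀)
  open import Data.Rational
  open import Data.Rational.Properties
  open import Data.Rational.Solver using (module +-*-Solver)
  open import Relation.Binary.PropositionalEquality
  open import Defs using (ℕtoℚ; _÷ᵗ_)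
  open RationalFacts
  open +-*-Solver
  open Terms σ₁ σb N n t public

  private
    r rₙ rₜ s' P' N' t' j' n' two four : ℚ
    r = recip k             -- 1/N
    rₙ = recip (t ℕ.+ j)     -- 1/n
    rₜ = recip t             -- 1/(t+1)
    s' = ℕtoℚ σ₁
    P' = ℕtoℚ σb
    N' = ℕtoℚ N
    t' = ℕtoℚ t
    j' = ℕtoℚ j
    n' = ℕtoℚ n
    two = ℕtoℚ 2
    four = ℕtoℚ 4

    ÷N : ∀ x → x ÷ᵗ N' ≡ x * r
    ÷N x rewrite N≡ = ÷ᵗ-suc x k

    N*r : N' * r ≡ 1ℚ
    N*r rewrite N≡ = recip-inverse k

    n'≡ : n' ≡ 1ℚ + (t' + j')
    n'≡ rewrite n≡ = trans (ℕtoℚ-suc (t ℕ.+ j)) (cong (1ℚ +_) (ℕtoℚ-+ t j))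

    n*rₙ : (1ℚ + (t' + j')) * rₙ ≡ 1ℚ
    n*rₙ = trans (cong (_* rₙ) (sym (trans (ℕtoℚ-suc (t ℕ.+ j)) (cong (1ℚ +_) (ℕtoℚ-+ t j)))))
                 (recip-inverse (t ℕ.+ j))

    [t+1]*rₜ : (1ℚ + t') * rₜ ≡ 1ℚ
    [t+1]*rₜ = trans (cong (_* rₜ) (sym (ℕtoℚ-suc t))) (recip-inverse t)

    firstℚ : s' * n' ≡ j' * (1ℚ + j') * N'
    firstℚ = trans (sym (ℕtoℚ-* σ₁ n)) (trans (cong ℕtoℚ first)
               (trans (ℕtoℚ-* (j ℕ.* suc j) N)
                      (cong (_* N') (trans (ℕtoℚ-* j (suc j)) (cong (j' *_) (ℕtoℚ-suc j))))))

    secondℚ : two * P' + s' ≡ j' * s'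
    secondℚ = trans (sym (trans (ℕtoℚ-+ (2 ℕ.* σb) σ₁) (cong (_+ s') (ℕtoℚ-* 2 σb))))
                    (trans (cong ℕtoℚ second) (ℕtoℚ-* j σ₁))

  S≡ : S ≡ j' * (1ℚ + j') * rₙ
  S≡ = begin
    S                                ≡⟨ ÷N s' ⟩
    s' * r                           ≡⟨ sym (*-identityʳ _) ⟩
    s' * r * 1ℚ                      ≡⟨ cong (s' * r *_) (sym (trans (cong (_* rₙ) n'≡) n*rₙ)) ⟩
    s' * r * (n' * rₙ)               ≡⟨ solve 4 (λ x y z w → x :* y :* (z :* w) := (x :* z) :* y :* w) refl s' r n' rₙ ⟩
    (s' * n') * r * rₙ               ≡⟨ cong (λ z → z * r * rₙ) firstℚ ⟩
    j' * (1ℚ + j') * N' * r * rₙ     ≡⟨ solve 4 (λ x y z w → x :* (con 1ℚ :+ x) :* y :* z :* w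
                                                      := x :* (con 1ℚ :+ x) :* w :* (y :* z)) refl j' N' r rₙ ⟩
    j' * (1ℚ + j') * rₙ * (N' * r)   ≡⟨ cong (j' * (1ℚ + j') * rₙ *_) N*r ⟩
    j' * (1ℚ + j') * rₙ * 1ℚ         ≡⟨ *-identityʳ _ ⟩
    j' * (1ℚ + j') * rₙ              ∎
    where open ≡-Reasoning

  b≡ : b ≡ j' * S
  b≡ = begin
    b                         ≡⟨ cong₂ (λ x y → x + two * y) (÷N s') (÷N P') ⟩
    s' * r + two * (P' * r)   ≡⟨ solve 4 (λ x y z w → x :* z :+ w :* (y :* z) := (w :* y :+ x) :* z) refl s' P' r two ⟩
    (two * P' + s') * r       ≡⟨ cong (_* r) secondℚ ⟩
    j' * s' * r               ≡⟨ *-assoc j' s' r ⟩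
    j' * (s' * r)             ≡⟨ cong (j' *_) (sym (÷N s')) ⟩
    j' * S                    ∎
    where open ≡-Reasoning

  denominator≡ : n' - a ≡ (1ℚ + j') * (1ℚ + t') * rₙ
  denominator≡ = begin
    n' - (t' + S)
      ≡⟨ cong₂ (λ x y → x - (t' + y)) n'≡ S≡ ⟩
    (1ℚ + (t' + j')) - (t' + j' * (1ℚ + j') * rₙ)
      ≡⟨ solve 3 (λ x y z → (con 1ℚ :+ (x :+ y)) :- (x :+ y :* (con 1ℚ :+ y) :* z)
                 := (con 1ℚ :+ y) :* con 1ℚ :- y :* (con 1ℚ :+ y) :* z) refl t' j' rₙ ⟩
    (1ℚ + j') * 1ℚ - j' * (1ℚ + j') * rₙ
      ≡⟨ cong (λ z → (1ℚ + j') * z - j' * (1ℚ + j') * rₙ) (sym n*rₙ) ⟩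
    (1ℚ + j') * ((1ℚ + (t' + j')) * rₙ) - j' * (1ℚ + j') * rₙ
      ≡⟨ solve 3 (λ x y z → (con 1ℚ :+ y) :* ((con 1ℚ :+ (x :+ y)) :* z) :- y :* (con 1ℚ :+ y) :* z
                 := (con 1ℚ :+ y) :* (con 1ℚ :+ x) :* z) refl t' j' rₙ ⟩
    (1ℚ + j') * (1ℚ + t') * rₙ ∎
    where open ≡-Reasoning

  -- b - S² = (n - a)·W  with  W = j²t/(n(t+1)).
  numerator≡ : b - S * S ≡ (1ℚ + j') * (1ℚ + t') * rₙ * (j' * j' * t' * rₙ * rₜ)
  numerator≡ = begin
    b - S * S
      ≡⟨ cong (_- S * S) b≡ ⟩
    j' * S - S * S
      ≡⟨ cong (λ z → j' * z - z * z) S≡ ⟩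
    j' * (j' * (1ℚ + j') * rₙ) - j' * (1ℚ + j') * rₙ * (j' * (1ℚ + j') * rₙ)
      ≡⟨ trans (sym (*-identityʳ _))
               (cong (λ z → (j' * (j' * (1ℚ + j') * rₙ) - j' * (1ℚ + j') * rₙ * (j' * (1ℚ + j') * rₙ)) * z)
                     (sym [t+1]*rₜ)) ⟩
    (j' * (j' * (1ℚ + j') * rₙ) - j' * (1ℚ + j') * rₙ * (j' * (1ℚ + j') * rₙ)) * ((1ℚ + t') * rₜ)
      ≡⟨ cong (λ z → (z - j' * (1ℚ + j') * rₙ * (j' * (1ℚ + j') * rₙ)) * ((1ℚ + t') * rₜ))
              (trans (sym (*-identityʳ (j' * (j' * (1ℚ + j') * rₙ)))) (cong (j' * (j' * (1ℚ + j') * rₙ) *_) (sym n*rₙ))) ⟩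
    (j' * (j' * (1ℚ + j') * rₙ) * ((1ℚ + (t' + j')) * rₙ) - j' * (1ℚ + j') * rₙ * (j' * (1ℚ + j') * rₙ)) * ((1ℚ + t') * rₜ)
      ≡⟨ solve 4 (λ x y z w → (y :* (y :* (con 1ℚ :+ y) :* z) :* ((con 1ℚ :+ (x :+ y)) :* z)
                                 :- y :* (con 1ℚ :+ y) :* z :* (y :* (con 1ℚ :+ y) :* z)) :* ((con 1ℚ :+ x) :* w)
                 := (con 1ℚ :+ y) :* (con 1ℚ :+ x) :* z :* (y :* y :* x :* z :* w)) refl t' j' rₙ rₜ ⟩
    (1ℚ + j') * (1ℚ + t') * rₙ * (j' * j' * t' * rₙ * rₜ) ∎
    where open ≡-Reasoning

  hm1≡ : hm1 ≡ t' + j' * rₜ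
  hm1≡ = begin
    a - (b - (a - t') * (a - t')) ÷ᵗ (n' - a)
      ≡⟨ cong (λ z → a - (b - z * z) ÷ᵗ (n' - a)) (solve 2 (λ x y → (x :+ y) :- x := y) refl t' S) ⟩
    a - (b - S * S) ÷ᵗ (n' - a)
      ≡⟨ cong₂ (λ x y → a - x ÷ᵗ y) numerator≡ denominator≡ ⟩
    a - ((1ℚ + j') * (1ℚ + t') * rₙ * W) ÷ᵗ ((1ℚ + j') * (1ℚ + t') * rₙ)
      ≡⟨ cong (λ q → a - q) (÷ᵗ-cancel _ W denominator-pos) ⟩
    t' + S - W
      ≡⟨ cong (λ z → t' + z - W) (trans S≡ (trans (sym (*-identityʳ _)) (cong (j' * (1ℚ + j') * rₙ *_) (sym [t+1]*rₜ)))) ⟩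
    t' + j' * (1ℚ + j') * rₙ * ((1ℚ + t') * rₜ) - W
      ≡⟨ solve 4 (λ x y z w → x :+ y :* (con 1ℚ :+ y) :* z :* ((con 1ℚ :+ x) :* w) :- y :* y :* x :* z :* w
                 := x :+ y :* w :* ((con 1ℚ :+ (x :+ y)) :* z)) refl t' j' rₙ rₜ ⟩
    t' + j' * rₜ * ((1ℚ + (t' + j')) * rₙ)
      ≡⟨ cong (λ z → t' + j' * rₜ * z) n*rₙ ⟩
    t' + j' * rₜ * 1ℚ
      ≡⟨ cong (t' +_) (*-identityʳ _) ⟩
    t' + j' * rₜ ∎
    where
    open ≡-Reasoning
    W : ℚ
    W = j' * j' * t' * rₙ * rₜ
    1+-pos : ∀ m → 0ℚ < 1ℚ + ℕtoℚ m
    1+-pos m = subst (0ℚ <_) (ℕtoℚ-suc m) (ℕtoℚ-mono-< {0} {suc m} (ℕ.s≤s ℕ.z≤n))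
    denominator-pos : 0ℚ < (1ℚ + j') * (1ℚ + t') * rₙ
    denominator-pos = *-pos (*-pos (1+-pos j) (1+-pos t)) (positive⁻¹ rₙ)

  hm1-nonneg : 0ℚ ≤ hm1
  hm1-nonneg = subst (0ℚ ≤_) (sym hm1≡)
    (subst (_≤ t' + j' * rₜ) (+-identityʳ 0ℚ) (+-mono-≤ (ℕtoℚ-nonneg t) (*-nonneg (ℕtoℚ-nonneg j) (recip-nonneg t))))

  -- 4a ≥ t + j, i.e. a ≥ (n - 1)/4 whatever t is; this follows from the
  -- polynomial inequality (t+j)(t+j+1) ≤ 4t(t+j+1) + 4j(j+1) by dividing by n.
  four-a-≥ : ℕtoℚ (t ℕ.+ j) ≤ four * a
  four-a-≥ = begin
      ℕtoℚ (t ℕ.+ j)                           ≡⟨ ℕtoℚ-+ t j ⟩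
      t' + j'                                  ≡⟨ sym (*-identityʳ _) ⟩
      (t' + j') * 1ℚ                           ≡⟨ cong ((t' + j') *_) (sym n*rₙ) ⟩
      (t' + j') * ((1ℚ + (t' + j')) * rₙ)      ≡⟨ sym (*-assoc (t' + j') (1ℚ + (t' + j')) rₙ) ⟩
      (t' + j') * (1ℚ + (t' + j')) * rₙ        ≤⟨ ≤-*ʳ rₙ (recip-nonneg _) polynomialℚ ⟩
      (four * t' * (1ℚ + (t' + j')) + four * (j' * (1ℚ + j'))) * rₙ
        ≡⟨ solve 4 (λ x y z f → (f :* x :* (con 1ℚ :+ (x :+ y)) :+ f :* (y :* (con 1ℚ :+ y))) :* z
                 := f :* x :* ((con 1ℚ :+ (x :+ y)) :* z) :+ f :* (y :* (con 1ℚ :+ y) :* z)) refl t' j' rₙ four ⟩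
      four * t' * ((1ℚ + (t' + j')) * rₙ) + four * (j' * (1ℚ + j') * rₙ)
        ≡⟨ cong (λ q → four * t' * q + four * (j' * (1ℚ + j') * rₙ)) n*rₙ ⟩
      four * t' * 1ℚ + four * (j' * (1ℚ + j') * rₙ)
        ≡⟨ solve 4 (λ x y z f → f :* x :* con 1ℚ :+ f :* (y :* (con 1ℚ :+ y) :* z)
                 := f :* (x :+ y :* (con 1ℚ :+ y) :* z)) refl t' j' rₙ four ⟩
      four * (t' + j' * (1ℚ + j') * rₙ)        ≡⟨ cong (λ z → four * (t' + z)) (sym S≡) ⟩
      four * a                                 ∎
    where
    open ≤-Reasoning
    expand : ∀ t j → 4 ℕ.* t ℕ.* suc (t ℕ.+ j) ℕ.+ 4 ℕ.* (j ℕ.* suc j) ≡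
      (t ℕ.+ j) ℕ.* suc (t ℕ.+ j) ℕ.+ (3 ℕ.* t ℕ.* t ℕ.+ 2 ℕ.* t ℕ.* j ℕ.+ 3 ℕ.* t ℕ.+ 3 ℕ.* j ℕ.* j ℕ.+ 3 ℕ.* j)
    expand = solve-∀
    polynomial : (t ℕ.+ j) ℕ.* suc (t ℕ.+ j) ℕ.≤ 4 ℕ.* t ℕ.* suc (t ℕ.+ j) ℕ.+ 4 ℕ.* (j ℕ.* suc j)
    polynomial = subst ((t ℕ.+ j) ℕ.* suc (t ℕ.+ j) ℕ.≤_) (sym (expand t j)) (ℕP.m≤m+n _ _)
    n-cast : ℕtoℚ (suc (t ℕ.+ j)) ≡ 1ℚ + (t' + j')
    n-cast = trans (ℕtoℚ-suc (t ℕ.+ j)) (cong (1ℚ +_) (ℕtoℚ-+ t j))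
    polynomialℚ : (t' + j') * (1ℚ + (t' + j')) ≤ four * t' * (1ℚ + (t' + j')) + four * (j' * (1ℚ + j'))
    polynomialℚ = subst₂ _≤_
       (trans (ℕtoℚ-* (t ℕ.+ j) (suc (t ℕ.+ j))) (cong₂ _*_ (ℕtoℚ-+ t j) n-cast))
       (trans (ℕtoℚ-+ (4 ℕ.* t ℕ.* suc (t ℕ.+ j)) (4 ℕ.* (j ℕ.* suc j))) (cong₂ _+_
          (trans (ℕtoℚ-* (4 ℕ.* t) (suc (t ℕ.+ j))) (cong₂ _*_ (ℕtoℚ-* 4 t) n-cast))
          (trans (ℕtoℚ-* 4 (j ℕ.* suc j)) (cong (four *_) (trans (ℕtoℚ-* j (suc j)) (cong (j' *_) (ℕtoℚ-suc j)))))))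
       (ℕtoℚ-mono-≤ polynomial)

-- The star K₁,L with L = m' + 2 ≥ 2 leaves, at a subset size 1 ≤ t ≤ L: its
-- counts satisfy the hypotheses of StarClosedForm with j = L - t.
module StarTerms (m' t : ℕ) (1≤t : 1 ℕ.≤ t) (t≤L : t ℕ.≤ ℕ.suc (ℕ.suc m')) where

  open import Data.Nat
  open import Data.Nat.Properties
  open import Data.Nat.Tactic.RingSolver using (solve-∀)
  open import Data.Nat.Combinatorics using (_C_)
  open import Relation.Binary.PropositionalEquality
  open import Relation.Nullary using (yes; no)
  open Binomial
  open StarGraph using (Star; module Counts)

  L j : ℕ
  L = suc (suc m')
  j = L ∸ t

  open Counts L
  open NeighbourhoodCounts (Star L) using (σ₁; σb)

  t+j≡L : t + j ≡ L
  t+j≡L = m+[n∸m]≡n t≤L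

  private
    N : ℕ
    N = suc L C t

    σ₁≡ : σ₁ t ≡ L * B (suc m') t
    σ₁≡ = σ₁-star t 1≤t (s≤s z≤n)

    first : σ₁ t * suc L ≡ j * suc j * N
    first = begin
      σ₁ t * suc L                    ≡⟨ cong (_* suc L) (trans σ₁≡ (B-raise (suc m') t)) ⟩
      j * B L t * suc L               ≡⟨ reorder j (B L t) (suc L) ⟩
      j * (suc L * B L t)             ≡⟨ cong (j *_) (B-raise L t) ⟩
      j * ((suc L ∸ t) * B (suc L) t) ≡⟨ cong₂ (λ x y → j * (x * y)) (+-∸-assoc 1 t≤L) (B≡C (suc L) t) ⟩
      j * (suc j * N)                 ≡⟨ sym (*-assoc j (suc j) N) ⟩
      j * suc j * N                   ∎
      where
      open ≡-Reasoning
      reorder : ∀ a b c → a * b * c ≡ a * (c * b)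
      reorder = solve-∀

    q : ℕ
    q = suc m' ∸ t

    twice-σb : 2 * σb t ≡ q * σ₁ t
    twice-σb = +-cancelʳ-≡ (L * c) (2 * σb t) (q * σ₁ t) (trans (σb-star t 1≤t (s≤s (s≤s z≤n))) L²c≡)
      where
      open ≡-Reasoning
      c : ℕ
      c = B m' t
      swap : ∀ a b c → a * (b * c) ≡ b * (a * c)
      swap = solve-∀
      L²c≡ : L * (L * c) ≡ q * σ₁ t + L * c
      L²c≡ = begin
        L * (c + suc m' * c)             ≡⟨ *-distribˡ-+ L c (suc m' * c) ⟩
        L * c + L * (suc m' * c)         ≡⟨ cong (λ z → L * c + L * z) (B-raise m' t) ⟩
        L * c + L * (q * B (suc m') t)   ≡⟨ cong (L * c +_) (swap L q (B (suc m') t)) ⟩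
        L * c + q * (L * B (suc m') t)   ≡⟨ cong (λ z → L * c + q * z) (sym σ₁≡) ⟩
        L * c + q * σ₁ t                 ≡⟨ +-comm (L * c) _ ⟩
        q * σ₁ t + L * c                 ∎

    -- (q + 1)·σ₁ = j·σ₁: for t ≤ L - 1 because q + 1 = j, and for t = L
    -- because then σ₁ = 0 (no leaf misses a set of all but one vertex).
    [q+1]σ₁≡jσ₁ : q * σ₁ t + σ₁ t ≡ j * σ₁ t
    [q+1]σ₁≡jσ₁ with t ≤? suc m'
    ... | yes t≤ = trans (+-comm (q * σ₁ t) (σ₁ t)) (cong (_* σ₁ t) (sym (+-∸-assoc 1 t≤)))
    ... | no t≰ = vanishing (trans σ₁≡ (trans (cong (L *_) (B-vanishes (suc m') t (≰⇒> t≰))) (*-zeroʳ L)))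
      where
      vanishing : ∀ {x} → x ≡ 0 → q * x + x ≡ j * x
      vanishing refl = trans (+-identityʳ (q * 0)) (trans (*-zeroʳ q) (sym (*-zeroʳ j)))

    second : 2 * σb t + σ₁ t ≡ j * σ₁ t
    second = trans (cong (_+ σ₁ t) twice-σb) [q+1]σ₁≡jσ₁

    N≡ : N ≡ suc (pred N)
    N≡ = sym (suc-pred N {{>-nonZero (subst (0 <_) (B≡C (suc L) t) (B-pos (suc L) t (m≤n⇒m≤1+n t≤L)))}})

  open StarClosedForm (σ₁ t) (σb t) N (pred N) (suc L) t j N≡ (cong suc (sym t+j≡L)) first second public

-- Part (3): along the stars K₁,k² (k = m + 2), γHM1 ≤ 2k while γCSSF ≥ k²/4.
module Part3 where

  open import Data.Nat as ℕ using (ℕ; suc; _∸_; z≤n; s≤s)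
  import Data.Nat.Properties as ℕP
  open import Data.Product using (Σ; _×_; _,_)
  open import Data.Rational using (ℚ; 0ℚ; 1ℚ; _<_; ∣_∣; _*_; _+_) renaming (_≤_ to _≤ℚ_)
  import Data.Rational.Properties as ℚP
  open import Data.Rational.Solver using (module +-*-Solver)
  open import Relation.Binary.PropositionalEquality
  open import Defs hiding (sym)
  open RationalFacts
  open MinOverRange using (minRange-≤; minRange-glb)
  open StarGraph using (Star; Star-InΓ; module Counts)
  open +-*-Solver

  module Member (m : ℕ) where

    k m' L : ℕ
    k = suc (suc m)
    m' = m ℕ.+ suc m ℕ.* suc (suc m)
    L = suc (suc m')      -- = k²

    G : Graph (suc L)
    G = Star L

    range≡ : suc L ∸ δ G ≡ L
    range≡ = cong (suc L ∸_) (Counts.δ-star L (s≤s z≤n))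

    module At (t : ℕ) (1≤t : 1 ℕ.≤ t) (t≤L : t ℕ.≤ L) = StarTerms m' t 1≤t t≤L

    γHM1-nonneg : 0ℚ ≤ℚ γHM1 G
    γHM1-nonneg = subst (λ K → 0ℚ ≤ℚ minRange (hm1Term G) K) (sym range≡)
                        (minRange-glb (hm1Term G) L 0ℚ (λ t p q → At.hm1-nonneg t p q) (s≤s z≤n))

    -- a(G,t) ≥ L/4 for every t, hence γCSSF ≥ L/4.
    γCSSF-≥ : ℕtoℚ L * recip 3 ≤ℚ γCSSF G
    γCSSF-≥ = subst (λ K → ℕtoℚ L * recip 3 ≤ℚ minRange (aG G) K) (sym range≡)
                    (minRange-glb (aG G) L _ a-≥ (s≤s z≤n))
      where
      a-≥ : ∀ t → 1 ℕ.≤ t → t ℕ.≤ L → ℕtoℚ L * recip 3 ≤ℚ aG G t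
      a-≥ t p q = ℚP.≤-trans
        (≤-*ʳ (recip 3) (recip-nonneg 3) (subst (λ z → ℕtoℚ z ≤ℚ ℕtoℚ 4 * aG G t) (At.t+j≡L t p q) (At.four-a-≥ t p q)))
        (ℚP.≤-reflexive (trans (solve 3 (λ x y z → x :* y :* z := y :* (x :* z)) refl (ℕtoℚ 4) (aG G t) (recip 3))
                               (trans (cong (aG G t *_) (recip-inverse 3)) (ℚP.*-identityʳ _))))

    γCSSF-pos : 0ℚ < γCSSF G
    γCSSF-pos = ℚP.<-≤-trans (*-pos (ℕtoℚ-mono-< {0} {L} (s≤s z≤n)) (ℚP.positive⁻¹ (recip 3))) γCSSF-≥

    -- At t = k: HM1 = k + (L - k)/(k+1) ≤ 2k.
    γHM1-≤ : γHM1 G ≤ℚ ℕtoℚ k + ℕtoℚ k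
    γHM1-≤ = ℚP.≤-trans (subst (λ K → minRange (hm1Term G) K ≤ℚ hm1Term G k) (sym range≡)
                                (minRange-≤ (hm1Term G) L k (s≤s z≤n) k≤L))
                        (subst (_≤ℚ ℕtoℚ k + ℕtoℚ k) (sym (At.hm1≡ k (s≤s z≤n) k≤L)) (ℚP.+-monoʳ-≤ (ℕtoℚ k) j/[k+1]≤k))
      where
      k≤L : k ℕ.≤ L
      k≤L = ℕP.m≤m*n k k
      j≤k[k+1] : L ∸ k ℕ.≤ k ℕ.* suc k
      j≤k[k+1] = ℕP.≤-trans (ℕP.m∸n≤m L k) (ℕP.*-monoʳ-≤ k (ℕP.n≤1+n k))
      j/[k+1]≤k : ℕtoℚ (L ∸ k) * recip k ≤ℚ ℕtoℚ k
      j/[k+1]≤k = ℚP.≤-trans (≤-*ʳ (recip k) (recip-nonneg k) (subst (ℕtoℚ (L ∸ k) ≤ℚ_) (ℕtoℚ-* k (suc k)) (ℕtoℚ-mono-≤ j≤k[k+1])))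
                    (ℚP.≤-reflexive (trans (ℚP.*-assoc (ℕtoℚ k) (ℕtoℚ (suc k)) (recip k))
                       (trans (cong (ℕtoℚ k *_) (recip-inverse k)) (ℚP.*-identityʳ _))))

    -- Once m ≥ 8(d+1) the ratio is below 1/(d+1): 2k·4(d+1) < k² = L.
    ratio-< : ∀ ε d → recip d ≤ℚ ε → 8 ℕ.* suc d ℕ.≤ m → ∣ γHM1 G ÷ᵗ γCSSF G ∣ < ε
    ratio-< ε d 1/[d+1]≤ε le =
      subst (_< ε) (sym (ℚP.0≤p⇒∣p∣≡p (÷ᵗ-nonneg _ _ γHM1-nonneg (ℚP.<⇒≤ γCSSF-pos))))
        (÷ᵗ-< (γHM1 G) ε (γCSSF G) γCSSF-pos (ℚP.≤-<-trans γHM1-≤ (ℚP.<-≤-trans 2k<L/[4d+4] lower)))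
      where
      ρ : ℚ
      ρ = recip d * recip 3
      lower : recip d * (ℕtoℚ L * recip 3) ≤ℚ ε * γCSSF G
      lower = ℚP.≤-trans (≤-*ʳ (ℕtoℚ L * recip 3) (*-nonneg (ℕtoℚ-nonneg L) (recip-nonneg 3)) 1/[d+1]≤ε)
                         (≤-*ˡ ε (ℚP.≤-trans (recip-nonneg d) 1/[d+1]≤ε) γCSSF-≥)
      2k·4[d+1]<L : (k ℕ.+ k) ℕ.* (4 ℕ.* suc d) ℕ.< L
      2k·4[d+1]<L = subst (ℕ._< L) (sym (regroup k d)) (ℕP.*-monoʳ-< k (ℕP.≤-trans (s≤s le) (ℕP.n≤1+n _)))
        where
        regroup : ∀ k d → (k ℕ.+ k) ℕ.* (4 ℕ.* suc d) ≡ k ℕ.* (8 ℕ.* suc d)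
        regroup = solve-∀
          where open import Data.Nat.Tactic.RingSolver using (solve-∀)
      2k<L/[4d+4] : ℕtoℚ k + ℕtoℚ k < recip d * (ℕtoℚ L * recip 3)
      2k<L/[4d+4] = subst₂ _<_ lhs rhs
        (ℚP.*-monoˡ-<-pos ρ {{Data.Rational.positive (*-pos (ℚP.positive⁻¹ (recip d)) (ℚP.positive⁻¹ (recip 3)))}}
                          (ℕtoℚ-mono-< 2k·4[d+1]<L))
        where
        kk : ℚ
        kk = ℕtoℚ k + ℕtoℚ k
        lhs : ℕtoℚ ((k ℕ.+ k) ℕ.* (4 ℕ.* suc d)) * ρ ≡ kk
        lhs = begin
          ℕtoℚ ((k ℕ.+ k) ℕ.* (4 ℕ.* suc d)) * ρ
            ≡⟨ cong (_* ρ) (trans (ℕtoℚ-* (k ℕ.+ k) (4 ℕ.* suc d)) (cong₂ _*_ (ℕtoℚ-+ k k) (ℕtoℚ-* 4 (suc d)))) ⟩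
          kk * (ℕtoℚ 4 * ℕtoℚ (suc d)) * (recip d * recip 3)
            ≡⟨ solve 5 (λ a b c x y → a :* (b :* c) :* (x :* y) := a :* (b :* y) :* (c :* x)) refl
                       kk (ℕtoℚ 4) (ℕtoℚ (suc d)) (recip d) (recip 3) ⟩
          kk * (ℕtoℚ 4 * recip 3) * (ℕtoℚ (suc d) * recip d)
            ≡⟨ cong₂ (λ x y → kk * x * y) (recip-inverse 3) (recip-inverse d) ⟩
          kk * 1ℚ * 1ℚ
            ≡⟨ trans (ℚP.*-identityʳ _) (ℚP.*-identityʳ _) ⟩
          kk ∎
          where open ≡-Reasoning
        rhs : ℕtoℚ L * ρ ≡ recip d * (ℕtoℚ L * recip 3)
        rhs = solve 3 (λ a x y → a :* (x :* y) := x :* (a :* y)) refl (ℕtoℚ L) (recip d) (recip 3)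

  part3 : Σ (ℕ → ℕ) λ size → Σ ((m : ℕ) → Graph (size m)) λ Gs →
          ((m : ℕ) → InΓ (Gs m))
          × ((ε : ℚ) → 0ℚ < ε → Σ ℕ λ M → (m : ℕ) → M ℕ.≤ m → ∣ γHM1 (Gs m) ÷ᵗ γCSSF (Gs m) ∣ < ε)
  part3 = (λ m → suc (Member.L m)) , Member.G , (λ m → Star-InΓ (Member.m' m))
        , λ ε ε>0 → let (d , 1/[d+1]≤ε) = recip-below ε ε>0
                    in 8 ℕ.* suc d , λ m le → Member.ratio-< m ε d 1/[d+1]≤ε le

open import Data.Nat using (_≤_)
open import Data.Rational using (ℚ; 0ℚ; _<_; ∣_∣; _<?_) renaming (_≤_ to _≤ℚ_)
open import Data.Product using (Σ; _×_; _,_)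
open import Relation.Nullary.Decidable using (toWitness)
open import Defs using (InΓ; γHM1; γHM2; γCSSF; _÷ᵗ_)
open StarGraph using (Star; Star-InΓ)

theorem4 :
    ((n : ℕ) (G : Graph n) → InΓ G → (γHM1 G ≤ℚ γCSSF G) × (γHM1 G ≤ℚ γHM2 G))
    × (Σ ℕ λ n₁ → Σ (Graph n₁) λ G₁ → InΓ G₁ × (γHM2 G₁ < γCSSF G₁))
    × (Σ ℕ λ n₂ → Σ (Graph n₂) λ G₂ → InΓ G₂ × (γCSSF G₂ < γHM2 G₂))
    × (Σ (ℕ → ℕ) λ size → Σ ((m : ℕ) → Graph (size m)) λ Gs →
        ((m : ℕ) → InΓ (Gs m))
        × ((ε : ℚ) → 0ℚ < ε → Σ ℕ λ M → (m : ℕ) → M ≤ m →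
             ∣ γHM1 (Gs m) ÷ᵗ γCSSF (Gs m) ∣ < ε))
theorem4 =
    Part1.part1
    -- Part (2): HM2 and CSSF are incomparable, witnessed by K₁,₃ and K₁,₄
    -- (both strict inequalities are decided by evaluation).
  , (4 , Star 3 , Star-InΓ 1 , toWitness {a? = γHM2 (Star 3) <? γCSSF (Star 3)} _)
  , (5 , Star 4 , Star-InΓ 2 , toWitness {a? = γCSSF (Star 4) <? γHM2 (Star 4)} _)
  , Part3.part3
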